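{- For integers $n\ge 0$ and $1\le k\le n+1$, \[ a_k(n+1)=\sum_{j=0}^{n}\binom{n}{j}\sum_{\substack{2r+s=k-1\\ r,s\ge 0}}\bigl(a_{2r}(j)+a_{2r+1}(j)\bigr)\,a_s(n-j). \]
   Context: For a permutation $w=w_1\cdots w_n$ of $\{1,\dots,n\}$, a subsequence $w_{i_1}\cdots w_{i_k}$ ($i_1<\cdots<i_k$) is alternating if $w_{i_1}>w_{i_2}<w_{i_3}>w_{i_4}<\cdots$ (starting with a descent; length-$1$ sequences are alternating). Let $\mathrm{as}(w)$ be the maximum length of an alternating subsequence of $w$ (with $\mathrm{as}=0$ for the empty permutation of $\{1,\dots,0\}$). For $k,n\ge 0$ let $a_k(n)$ be the number of permutations $w$ of $\{1,\dots,n\}$ with $\mathrm{as}(w)=k$; so $a_0(0)=1$, and $a_0(n)=0$ for $n\ge1$. -}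

module Defs where

open import Data.Bool using (Bool; true; false; _∧_; not; if_then_else_)
open import Data.Nat using (ℕ; zero; suc; _+_; _*_; _∸_; _<ᵇ_; _≡ᵇ_; _⊔_)
open import Data.List using (List; []; _∷_; map; concatMap; filter; length; foldr; upTo; applyUpTo)
open import Data.Nat.ListAction using (sum)
open import Data.Nat.Combinatorics using (_C_)
open import Relation.Nullary.Decidable using (does)
open import Data.Bool.Properties using (T?)

wordsOver : List ℕ → ℕ → List (List ℕ)
wordsOver xs zero    = [] ∷ []
wordsOver xs (suc m) = concatMap (λ x → map (x ∷_) (wordsOver xs m)) xs

elem : ℕ → List ℕ → Bool
elem x []       = false
elem x (y ∷ ys) = (x ≡ᵇ y) Data.Bool.∨ elem x ys

distinct : List ℕ → Bool
distinct []       = true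
distinct (x ∷ xs) = not (elem x xs) ∧ distinct xs

perms : ℕ → List (List ℕ)
perms n = filter (λ w → T? (distinct w)) (wordsOver (applyUpTo suc n) n)

subseqs : List ℕ → List (List ℕ)
subseqs []       = [] ∷ []
subseqs (x ∷ xs) = map (x ∷_) (subseqs xs) Data.List.++ subseqs xs

altDown altUp : List ℕ → Bool
altDown []           = true
altDown (x ∷ [])     = true
altDown (x ∷ y ∷ ys) = (y <ᵇ x) ∧ altUp (y ∷ ys)
altUp []           = true
altUp (x ∷ [])     = true
altUp (x ∷ y ∷ ys) = (x <ᵇ y) ∧ altDown (y ∷ ys)

-- as(w): maximum length of an alternating subsequence of w
-- (the empty subsequence counts, so as(empty permutation) = 0).
as : List ℕ → ℕ
as w = foldr _⊔_ 0 (map length (filter (λ u → T? (altDown u)) (subseqs w)))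

a : ℕ → ℕ → ℕ
a k n = length (filter (λ w → T? (as w ≡ᵇ k)) (perms n))

Σ≤ : ℕ → (ℕ → ℕ) → ℕ
Σ≤ m f = sum (map f (upTo (suc m)))

innerSum : ℕ → ℕ → ℕ → ℕ
innerSum k n j =
  Σ≤ k (λ r → Σ≤ k (λ s →
    if (2 * r + s) ≡ᵇ (k ∸ 1)
    then (a (2 * r) j + a (2 * r + 1) j) * a s (n ∸ j)
    else 0))

rhs : ℕ → ℕ → ℕ
rhs k n = Σ≤ n (λ j → (n C j) * innerSum k n j)

{-# OPTIONS --safe #-}
module Submission where

-- Split a permutation w of 1, …, n + 1 around its largest letter, w = u (n + 1) v. An alternating
-- subsequence can only climb to n + 1 after an even number of letters, and after n + 1 it continues
-- with a subsequence of v that starts with an ascent; taking the longest even-length piece from u and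
-- the longest such piece from v shows as(w) = 2⌊as(u)/2⌋ + 1 + as↑(v), where as↑ is the variant of as
-- starting with an ascent. Both statistics only depend on the relative order of the letters, and
-- complementation x ↦ m + 1 - x turns as↑ into as, so a_s(m) also counts permutations of size m with
-- as↑ = s. For any statistic F of a prefix and a suffix depending only on relative orders,
--   ∑_{w ∈ S_n} F(w₁⋯w_j, w_{j+1}⋯w_n) = C(n, j) ∑_{p ∈ S_j} ∑_{q ∈ S_{n-j}} F(p, q),
-- which follows by induction on n by inserting the largest letter. Since 2⌊x/2⌋ = 2r exactly when
-- x ∈ {2r, 2r + 1}, summing over the position j of n + 1 gives the formula.

open import Defs
open import Data.Bool using (Bool; true; false; _∧_; _∨_; not; T; if_then_else_)
open import Data.Bool.Properties using (T?; T-∧; T-∨; T-≡; T-not-≡; not-involutive; not-¬; ∧-comm)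
open import Data.Empty using (⊥-elim)
open import Data.List
  using (List; []; _∷_; [_]; _++_; map; filterᵇ; length; foldr; take; drop; concatMap; applyUpTo; applyDownFrom)
open import Data.List.Properties
  using ( length-++; length-map; length-applyUpTo; map-++; map-∘; map-id; map-cong; map-cong-local; map-applyUpTo
        ; applyUpTo-∷ʳ; concatMap-cong; filter-++; filter-all; filter-accept; filter-reject; filter-notAll)
open import Data.List.Membership.Propositional using (_∈_; _∉_)
open import Data.List.Membership.Propositional.Properties
  using (∈-map⁺; ∈-map⁻; ∈-++⁺ˡ; ∈-++⁺ʳ; ∈-++⁻; ∈-filter⁺; ∈-filter⁻
        ; ∈-applyUpTo⁺; ∈-applyUpTo⁻)
open import Data.List.Relation.Binary.Permutation.Propositional as ↭
  using (_↭_; ↭-refl; ↭-prep; ↭-trans; ↭-reflexive)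
open import Data.List.Relation.Binary.Permutation.Propositional.Properties
  using (filter-↭)
  renaming (map⁺ to ↭-map⁺; ++⁺ to ↭-++⁺; ++⁺ˡ to ↭-++⁺ˡ; shifts to ↭-shifts; ∷↭∷ʳ to ↭-∷↭∷ʳ)
open import Data.List.Relation.Binary.Sublist.Propositional using (_⊆_; []; _∷_; _∷ʳ_; ⊆-trans; minimum)
open import Data.List.Relation.Binary.Sublist.Propositional.Properties using (++⁺; ∷⁻; All-resp-⊆; Any-resp-⊆)
open import Data.List.Relation.Unary.All as All using (All; []; _∷_)
open import Data.List.Relation.Unary.All.Properties as All using ()
open import Data.List.Relation.Unary.Any as Any using (here; there)
open import Data.Nat
open import Data.Nat.Combinatorics using (_C_; nCk+nC[k+1]≡[n+1]C[k+1]; k>n⇒nCk≡0)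
open import Data.Nat.ListAction using (sum)
open import Data.Nat.ListAction.Properties using (sum-++; sum-↭)
open import Data.Nat.Properties
open import Algebra.Properties.CommutativeSemigroup +-commutativeSemigroup
  using () renaming (interchange to +-interchange; x∙yz≈y∙xz to +-exchange)
open import Data.Product using (∃-syntax; _×_; _,_; proj₁; proj₂)
open import Data.Sum using (_⊎_; inj₁; inj₂)
open import Function using (_∘_; id)
open import Function.Bundles using (module Equivalence)
open import Relation.Binary.Core using (_Preserves_⟶_)
open import Relation.Binary.Definitions using (tri<; tri≈; tri>)
open import Relation.Binary.PropositionalEquality hiding ([_])
open import Relation.Nullary using (¬_; yes; no)

private
  variable
    A B : Set

≡ᵇ-refl : ∀ n → T (n ≡ᵇ n)
≡ᵇ-refl n = ≡⇒≡ᵇ n n refl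

T-not⇒¬T : ∀ {b} → T (not b) → ¬ T b
T-not⇒¬T {true} ()

¬T⇒T-not : ∀ {b} → ¬ T b → T (not b)
¬T⇒T-not {true}  ¬b = ¬b _
¬T⇒T-not {false} _  = _

¬T⇒≡false : ∀ {b} → ¬ T b → b ≡ false
¬T⇒≡false ¬b = Equivalence.to T-not-≡ (¬T⇒T-not ¬b)

≢⇒T-not-≡ᵇ : ∀ {m n} → m ≢ n → T (not (m ≡ᵇ n))
≢⇒T-not-≡ᵇ {m} {n} m≢n = ¬T⇒T-not (m≢n ∘ ≡ᵇ⇒≡ m n)

<⇒<ᵇ≡true : ∀ {m n} → m < n → (m <ᵇ n) ≡ true
<⇒<ᵇ≡true m<n = Equivalence.to T-≡ (<⇒<ᵇ m<n)

≮⇒<ᵇ≡false : ∀ {m n} → ¬ m < n → (m <ᵇ n) ≡ false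
≮⇒<ᵇ≡false m≮n = ¬T⇒≡false (m≮n ∘ <ᵇ⇒< _ _)

filterᵇ-cong : ∀ {p q : A → Bool} {xs} → All (λ x → p x ≡ q x) xs → filterᵇ p xs ≡ filterᵇ q xs
filterᵇ-cong                     []                = refl
filterᵇ-cong {p = p} {q} {x ∷ _} (px≡qx ∷ pxs≡qxs) with p x | q x | px≡qx
... | true  | true  | _ = cong (x ∷_) (filterᵇ-cong pxs≡qxs)
... | false | false | _ = filterᵇ-cong pxs≡qxs

filterᵇ-false : ∀ (xs : List A) → filterᵇ (λ _ → false) xs ≡ []
filterᵇ-false []       = refl
filterᵇ-false (x ∷ xs) = filterᵇ-false xs

filterᵇ-map : ∀ (p : B → Bool) (f : A → B) xs → filterᵇ p (map f xs) ≡ map f (filterᵇ (p ∘ f) xs)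
filterᵇ-map p f []       = refl
filterᵇ-map p f (x ∷ xs) with p (f x)
... | true  = cong (f x ∷_) (filterᵇ-map p f xs)
... | false = filterᵇ-map p f xs

filterᵇ-concatMap : ∀ (p : B → Bool) (f : A → List B) xs →
                    filterᵇ p (concatMap f xs) ≡ concatMap (filterᵇ p ∘ f) xs
filterᵇ-concatMap p f []       = refl
filterᵇ-concatMap p f (x ∷ xs) =
  trans (filter-++ (T? ∘ p) (f x) (concatMap f xs)) (cong (filterᵇ p (f x) ++_) (filterᵇ-concatMap p f xs))

filterᵇ-∧ : ∀ (p q : A → Bool) xs → filterᵇ (λ x → p x ∧ q x) xs ≡ filterᵇ q (filterᵇ p xs)
filterᵇ-∧ p q []       = refl
filterᵇ-∧ p q (x ∷ xs) with p x
... | false = filterᵇ-∧ p q xs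
... | true with q x
...   | true  = cong (x ∷_) (filterᵇ-∧ p q xs)
...   | false = filterᵇ-∧ p q xs

filterᵇ-comm : ∀ (p q : A → Bool) xs → filterᵇ p (filterᵇ q xs) ≡ filterᵇ q (filterᵇ p xs)
filterᵇ-comm p q xs = begin
  filterᵇ p (filterᵇ q xs)      ≡⟨ filterᵇ-∧ q p xs ⟨
  filterᵇ (λ x → q x ∧ p x) xs  ≡⟨ filterᵇ-cong (All.universal (λ x → ∧-comm (q x) (p x)) xs) ⟩
  filterᵇ (λ x → p x ∧ q x) xs  ≡⟨ filterᵇ-∧ p q xs ⟩
  filterᵇ q (filterᵇ p xs)      ∎
  where open ≡-Reasoning

⟦_⟧ : Bool → ℕ
⟦ true  ⟧ = 1
⟦ false ⟧ = 0

¬T⇒⟦⟧≡0 : ∀ {b} → ¬ T b → ⟦ b ⟧ ≡ 0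
¬T⇒⟦⟧≡0 {false} _  = refl
¬T⇒⟦⟧≡0 {true}  ¬b = ⊥-elim (¬b _)

∑ : List A → (A → ℕ) → ℕ
∑ xs f = sum (map f xs)

syntax ∑ xs (λ x → e) = ∑[ x ∈ xs ] e

∑< : ℕ → (ℕ → ℕ) → ℕ
∑< zero    f = 0
∑< (suc n) f = f 0 + ∑< n (λ i → f (suc i))

syntax ∑< n (λ i → e) = ∑[ i < n ] e

∑-++ : ∀ (xs ys : List A) f → ∑ (xs ++ ys) f ≡ ∑ xs f + ∑ ys f
∑-++ xs ys f = trans (cong sum (map-++ f xs ys)) (sum-++ (map f xs) (map f ys))

∑-map : ∀ (g : A → B) xs f → ∑ (map g xs) f ≡ ∑[ x ∈ xs ] f (g x)
∑-map g []       f = refl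
∑-map g (x ∷ xs) f = cong (f (g x) +_) (∑-map g xs f)

∑-concatMap : ∀ (g : A → List B) xs f → ∑ (concatMap g xs) f ≡ ∑[ x ∈ xs ] ∑ (g x) f
∑-concatMap g []       f = refl
∑-concatMap g (x ∷ xs) f = trans (∑-++ (g x) _ f) (cong (∑ (g x) f +_) (∑-concatMap g xs f))

∑-cong-All : ∀ {f g : A → ℕ} {xs} → All (λ x → f x ≡ g x) xs → ∑ xs f ≡ ∑ xs g
∑-cong-All []           = refl
∑-cong-All (fx≡gx ∷ eqs) = cong₂ _+_ fx≡gx (∑-cong-All eqs)

∑-cong : ∀ {f g : A → ℕ} xs → (∀ x → f x ≡ g x) → ∑ xs f ≡ ∑ xs g
∑-cong xs f≗g = ∑-cong-All (All.universal f≗g xs)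

∑-zero : ∀ (xs : List A) → ∑[ x ∈ xs ] 0 ≡ 0
∑-zero []       = refl
∑-zero (x ∷ xs) = ∑-zero xs

∑-distrib-+ : ∀ (xs : List A) f g → ∑[ x ∈ xs ] (f x + g x) ≡ ∑ xs f + ∑ xs g
∑-distrib-+ []       f g = refl
∑-distrib-+ (x ∷ xs) f g =
  trans (cong (f x + g x +_) (∑-distrib-+ xs f g)) (+-interchange (f x) (g x) (∑ xs f) (∑ xs g))

*-distribˡ-∑ : ∀ c (xs : List A) f → c * ∑ xs f ≡ ∑[ x ∈ xs ] (c * f x)
*-distribˡ-∑ c []       f = *-zeroʳ c
*-distribˡ-∑ c (x ∷ xs) f = trans (*-distribˡ-+ c (f x) _) (cong (c * f x +_) (*-distribˡ-∑ c xs f))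

*-distribʳ-∑ : ∀ c (xs : List A) f → ∑ xs f * c ≡ ∑[ x ∈ xs ] (f x * c)
*-distribʳ-∑ c []       f = refl
*-distribʳ-∑ c (x ∷ xs) f = trans (*-distribʳ-+ c (f x) _) (cong (f x * c +_) (*-distribʳ-∑ c xs f))

∑-↭ : ∀ {xs ys : List A} f → xs ↭ ys → ∑ xs f ≡ ∑ ys f
∑-↭ f p = sum-↭ (↭-map⁺ f p)

length-filterᵇ : ∀ (p : A → Bool) xs → length (filterᵇ p xs) ≡ ∑[ x ∈ xs ] ⟦ p x ⟧
length-filterᵇ p []       = refl
length-filterᵇ p (x ∷ xs) with p x
... | true  = cong suc (length-filterᵇ p xs)
... | false = length-filterᵇ p xs

∑<-cong : ∀ n {f g : ℕ → ℕ} → (∀ {i} → i < n → f i ≡ g i) → ∑< n f ≡ ∑< n g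
∑<-cong zero    f≗g = refl
∑<-cong (suc n) f≗g = cong₂ _+_ (f≗g z<s) (∑<-cong n (λ i<n → f≗g (s<s i<n)))

∑<-cong′ : ∀ n {f g : ℕ → ℕ} → (∀ i → f i ≡ g i) → ∑< n f ≡ ∑< n g
∑<-cong′ n f≗g = ∑<-cong n (λ {i} _ → f≗g i)

*-distribˡ-∑< : ∀ c n f → c * ∑< n f ≡ ∑[ i < n ] (c * f i)
*-distribˡ-∑< c zero    f = *-zeroʳ c
*-distribˡ-∑< c (suc n) f =
  trans (*-distribˡ-+ c (f 0) _) (cong (c * f 0 +_) (*-distribˡ-∑< c n (λ i → f (suc i))))

∑<-+ : ∀ m n f → ∑< (m + n) f ≡ ∑< m f + ∑[ i < n ] f (m + i)
∑<-+ zero    n f = refl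
∑<-+ (suc m) n f = trans (cong (f 0 +_) (∑<-+ m n (λ i → f (suc i)))) (sym (+-assoc (f 0) _ _))

∑<-∑-comm : ∀ n (xs : List A) (f : ℕ → A → ℕ) →
            ∑[ i < n ] ∑[ x ∈ xs ] f i x ≡ ∑[ x ∈ xs ] ∑[ i < n ] f i x
∑<-∑-comm zero    xs f = sym (∑-zero xs)
∑<-∑-comm (suc n) xs f =
  trans (cong (∑ xs (f 0) +_) (∑<-∑-comm n xs (λ i → f (suc i)))) (sym (∑-distrib-+ xs (f 0) _))

∑<-zero : ∀ n → ∑[ i < n ] 0 ≡ 0
∑<-zero zero    = refl
∑<-zero (suc n) = ∑<-zero n

sum-map-applyUpTo : ∀ (f g : ℕ → ℕ) n → sum (map f (applyUpTo g n)) ≡ ∑[ i < n ] f (g i)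
sum-map-applyUpTo f g zero    = refl
sum-map-applyUpTo f g (suc n) = cong (f (g 0) +_) (sum-map-applyUpTo f (g ∘ suc) n)

∑<-δ : ∀ N y (G : ℕ → ℕ) → (¬ y < N → G y ≡ 0) → ∑[ s < N ] (⟦ y ≡ᵇ s ⟧ * G s) ≡ G y
∑<-δ zero    y       G out = sym (out λ ())
∑<-δ (suc N) zero    G _   = trans (cong (1 * G 0 +_) (∑<-zero N)) (trans (+-identityʳ _) (*-identityˡ _))
∑<-δ (suc N) (suc y) G out = ∑<-δ N y (G ∘ suc) (λ y≮N → out (y≮N ∘ s<s⁻¹))

if-then-0≡⟦⟧* : ∀ b t → (if b then t else 0) ≡ ⟦ b ⟧ * t
if-then-0≡⟦⟧* true  t = sym (+-identityʳ t)
if-then-0≡⟦⟧* false t = refl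

*-distrib-∑∑ : ∀ c (P : List A) (Q : List B) f g →
               c * (∑ P f * ∑ Q g) ≡ ∑[ p ∈ P ] ∑[ q ∈ Q ] (c * (f p * g q))
*-distrib-∑∑ c P Q f g = begin
  c * (∑ P f * ∑ Q g)                       ≡⟨ cong (c *_) (*-distribʳ-∑ (∑ Q g) P f) ⟩
  c * ∑[ p ∈ P ] (f p * ∑ Q g)              ≡⟨ cong (c *_) (∑-cong P (λ p → *-distribˡ-∑ (f p) Q g)) ⟩
  c * ∑[ p ∈ P ] ∑[ q ∈ Q ] (f p * g q)     ≡⟨ *-distribˡ-∑ c P _ ⟩
  ∑[ p ∈ P ] (c * ∑[ q ∈ Q ] (f p * g q))   ≡⟨ ∑-cong P (λ p → *-distribˡ-∑ c Q (λ q → f p * g q)) ⟩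
  ∑[ p ∈ P ] ∑[ q ∈ Q ] (c * (f p * g q))   ∎
  where open ≡-Reasoning

∑<∑<-∑∑-comm : ∀ N M (P : List A) (Q : List B) (f : ℕ → ℕ → A → B → ℕ) →
  ∑[ r < N ] ∑[ s < M ] ∑[ p ∈ P ] ∑[ q ∈ Q ] f r s p q ≡
  ∑[ p ∈ P ] ∑[ q ∈ Q ] ∑[ r < N ] ∑[ s < M ] f r s p q
∑<∑<-∑∑-comm N M P Q f = begin
  ∑[ r < N ] ∑[ s < M ] ∑[ p ∈ P ] ∑[ q ∈ Q ] f r s p q  ≡⟨ ∑<-cong′ N (λ r → ∑<-∑-comm M P _) ⟩
  ∑[ r < N ] ∑[ p ∈ P ] ∑[ s < M ] ∑[ q ∈ Q ] f r s p q  ≡⟨ ∑<-cong′ N (λ r → ∑-cong P λ p → ∑<-∑-comm M Q _) ⟩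
  ∑[ r < N ] ∑[ p ∈ P ] ∑[ q ∈ Q ] ∑[ s < M ] f r s p q  ≡⟨ ∑<-∑-comm N P _ ⟩
  ∑[ p ∈ P ] ∑[ r < N ] ∑[ q ∈ Q ] ∑[ s < M ] f r s p q  ≡⟨ ∑-cong P (λ p → ∑<-∑-comm N Q _) ⟩
  ∑[ p ∈ P ] ∑[ q ∈ Q ] ∑[ r < N ] ∑[ s < M ] f r s p q  ∎
  where open ≡-Reasoning

-- Longest sublists with a given property

⊆⇒∈-subseqs : ∀ {z w} → z ⊆ w → z ∈ subseqs w
⊆⇒∈-subseqs []                    = here refl
⊆⇒∈-subseqs {w = x ∷ w} (refl ∷ s) = ∈-++⁺ˡ (∈-map⁺ (x ∷_) (⊆⇒∈-subseqs s))
⊆⇒∈-subseqs {w = x ∷ w} (.x ∷ʳ s)  = ∈-++⁺ʳ (map (x ∷_) (subseqs w)) (⊆⇒∈-subseqs s)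

∈-subseqs⇒⊆ : ∀ {z} w → z ∈ subseqs w → z ⊆ w
∈-subseqs⇒⊆ []      (here refl) = []
∈-subseqs⇒⊆ (x ∷ w) z∈ with ∈-++⁻ (map (x ∷_) (subseqs w)) {subseqs w} z∈
... | inj₂ z∈ʳ = x ∷ʳ ∈-subseqs⇒⊆ w z∈ʳ
... | inj₁ z∈ˡ with ∈-map⁻ (x ∷_) z∈ˡ
...   | _ , z′∈ , refl = refl ∷ ∈-subseqs⇒⊆ w z′∈

⊆-++⁻ : ∀ {z} (u v : List A) → z ⊆ u ++ v → ∃[ z₁ ] ∃[ z₂ ] z ≡ z₁ ++ z₂ × z₁ ⊆ u × z₂ ⊆ v
⊆-++⁻ []      v s          = [] , _ , refl , [] , s
⊆-++⁻ (x ∷ u) v (refl ∷ s) with ⊆-++⁻ u v s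
... | z₁ , z₂ , refl , s₁ , s₂ = x ∷ z₁ , z₂ , refl , refl ∷ s₁ , s₂
⊆-++⁻ (x ∷ u) v (.x ∷ʳ s)  with ⊆-++⁻ u v s
... | z₁ , z₂ , refl , s₁ , s₂ = z₁ , z₂ , refl , x ∷ʳ s₁ , s₂

maxLengthIn : (List A → Bool) → List (List A) → ℕ
maxLengthIn P zs = foldr _⊔_ 0 (map length (filterᵇ P zs))

module _ (P : List A → Bool) where

  maxLengthIn-upper : ∀ {z} zs → z ∈ zs → T (P z) → length z ≤ maxLengthIn P zs
  maxLengthIn-upper (z ∷ zs) (here refl) pz with P z
  ... | true = m≤m⊔n (length z) _
  maxLengthIn-upper (z′ ∷ zs) (there z∈) pz with P z′
  ... | true  = ≤-trans (maxLengthIn-upper zs z∈ pz) (m≤n⊔m (length z′) _)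
  ... | false = maxLengthIn-upper zs z∈ pz

  maxLengthIn-least : ∀ zs {b} → (∀ {z} → z ∈ zs → T (P z) → length z ≤ b) → maxLengthIn P zs ≤ b
  maxLengthIn-least []       h = z≤n
  maxLengthIn-least (z ∷ zs) h with P z in pz
  ... | true  = ⊔-lub (h (here refl) (subst T (sym pz) _)) (maxLengthIn-least zs (λ z∈ → h (there z∈)))
  ... | false = maxLengthIn-least zs (λ z∈ → h (there z∈))

  maxLengthIn-attained : ∀ zs →
    maxLengthIn P zs ≡ 0 ⊎ ∃[ z ] z ∈ zs × T (P z) × length z ≡ maxLengthIn P zs
  maxLengthIn-attained []       = inj₁ refl
  maxLengthIn-attained (z ∷ zs) with P z in pz | maxLengthIn-attained zs
  ... | false | inj₁ e                  = inj₁ e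
  ... | false | inj₂ (z′ , z′∈ , p , e) = inj₂ (z′ , there z′∈ , p , e)
  ... | true  | rest with ⊔-sel (length z) (maxLengthIn P zs)
  ...   | inj₁ e = inj₂ (z , here refl , subst T (sym pz) _ , sym e)
  ...   | inj₂ e with rest
  ...     | inj₁ e₀                  = inj₁ (trans e e₀)
  ...     | inj₂ (z′ , z′∈ , p , e′) = inj₂ (z′ , there z′∈ , p , trans e′ (sym e))

maxLength : (List ℕ → Bool) → List ℕ → ℕ
maxLength P w = maxLengthIn P (subseqs w)

module _ (P : List ℕ → Bool) where

  maxLength-upper : ∀ {z} w → z ⊆ w → T (P z) → length z ≤ maxLength P w
  maxLength-upper w s = maxLengthIn-upper P (subseqs w) (⊆⇒∈-subseqs s)

  maxLength-least : ∀ w {b} → (∀ {z} → z ⊆ w → T (P z) → length z ≤ b) → maxLength P w ≤ b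
  maxLength-least w h = maxLengthIn-least P (subseqs w) (λ z∈ → h (∈-subseqs⇒⊆ w z∈))

  maxLength-attained : T (P []) → ∀ w → ∃[ z ] z ⊆ w × T (P z) × length z ≡ maxLength P w
  maxLength-attained p[] w with maxLengthIn-attained P (subseqs w)
  ... | inj₁ e                = [] , minimum w , p[] , sym e
  ... | inj₂ (z , z∈ , p , e) = z , ∈-subseqs⇒⊆ w z∈ , p , e

-- Alternating words

alternating : Bool → List ℕ → Bool
alternating true  = altDown
alternating false = altUp

step : Bool → ℕ → ℕ → Bool
step true  x y = y <ᵇ x
step false x y = x <ᵇ y

directionAfter : Bool → List ℕ → Bool
directionAfter d []      = d
directionAfter d (_ ∷ z) = directionAfter (not d) z

asUp : List ℕ → ℕ
asUp = maxLength altUp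

alternating-∷∷ : ∀ d x y r → alternating d (x ∷ y ∷ r) ≡ step d x y ∧ alternating (not d) (y ∷ r)
alternating-∷∷ true  x y r = refl
alternating-∷∷ false x y r = refl

alternating-[] : ∀ d → T (alternating d [])
alternating-[] true  = _
alternating-[] false = _

alternating-[x] : ∀ d x → T (alternating d [ x ])
alternating-[x] true  x = _
alternating-[x] false x = _

alternating-∷∷⁻ : ∀ d x y r → T (alternating d (x ∷ y ∷ r)) →
                  T (step d x y) × T (alternating (not d) (y ∷ r))
alternating-∷∷⁻ d x y r p = Equivalence.to (T-∧ {step d x y}) (subst T (alternating-∷∷ d x y r) p)

alternating-∷∷⁺ : ∀ d x y r → T (step d x y) → T (alternating (not d) (y ∷ r)) →
                  T (alternating d (x ∷ y ∷ r))
alternating-∷∷⁺ d x y r p q =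
  subst T (sym (alternating-∷∷ d x y r)) (Equivalence.from (T-∧ {step d x y}) (p , q))

alternating-tail : ∀ d x r → T (alternating d (x ∷ r)) → T (alternating (not d) r)
alternating-tail d x []      _ = alternating-[] (not d)
alternating-tail d x (y ∷ r) p = proj₂ (alternating-∷∷⁻ d x y r p)

alternating-++⁻ : ∀ d z₁ z₂ → T (alternating d (z₁ ++ z₂)) →
                  T (alternating d z₁) × T (alternating (directionAfter d z₁) z₂)
alternating-++⁻ d []           z₂ p = alternating-[] d , p
alternating-++⁻ d (x ∷ [])     z₂ p = alternating-[x] d x , alternating-tail d x z₂ p
alternating-++⁻ d (x ∷ y ∷ z₁) z₂ p =
  let xy , rest = alternating-∷∷⁻ d x y (z₁ ++ z₂) p
      p₁ , p₂   = alternating-++⁻ (not d) (y ∷ z₁) z₂ rest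
  in alternating-∷∷⁺ d x y z₁ xy p₁ , p₂

-- Entering a new maximum is an ascent, so the step leaving it is a descent.
directionAfter-max : ∀ d y z m r → T (alternating d (y ∷ z ++ m ∷ r)) → All (_< m) (y ∷ z) →
                     directionAfter d (y ∷ z) ≡ true
directionAfter-max true  y []       m r p (y<m ∷ _) =
  ⊥-elim (<-asym y<m (<ᵇ⇒< m y (proj₁ (alternating-∷∷⁻ true y m r p))))
directionAfter-max false y []       m r p _         = refl
directionAfter-max d     y (y′ ∷ z) m r p (_ ∷ z<m) =
  directionAfter-max (not d) y′ z m r (alternating-tail d y _ p) z<m

-- The longest alternating subsequence around a maximal letter

evenFloor : ℕ → ℕ
evenFloor (suc (suc n)) = suc (suc (evenFloor n))
evenFloor _             = 0

evenPrefix : List ℕ → List ℕ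
evenPrefix (x ∷ y ∷ z) = x ∷ y ∷ evenPrefix z
evenPrefix _           = []

length-evenPrefix : ∀ z → length (evenPrefix z) ≡ evenFloor (length z)
length-evenPrefix []          = refl
length-evenPrefix (x ∷ [])    = refl
length-evenPrefix (x ∷ y ∷ z) = cong (2 +_) (length-evenPrefix z)

evenPrefix-⊆ : ∀ z → evenPrefix z ⊆ z
evenPrefix-⊆ []          = []
evenPrefix-⊆ (x ∷ [])    = x ∷ʳ []
evenPrefix-⊆ (x ∷ y ∷ z) = refl ∷ refl ∷ evenPrefix-⊆ z

n≤1+evenFloor[n] : ∀ n → n ≤ suc (evenFloor n)
n≤1+evenFloor[n] zero          = z≤n
n≤1+evenFloor[n] (suc zero)    = s≤s z≤n
n≤1+evenFloor[n] (suc (suc n)) = s≤s (s≤s (n≤1+evenFloor[n] n))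

evenFloor-mono-≤ : ∀ {m n} → m ≤ n → evenFloor m ≤ evenFloor n
evenFloor-mono-≤ {zero}        _                 = z≤n
evenFloor-mono-≤ {suc zero}    _                 = z≤n
evenFloor-mono-≤ {suc (suc m)} (s≤s (s≤s m≤n)) = s≤s (s≤s (evenFloor-mono-≤ m≤n))

evenFloor-directionAfter : ∀ d z → directionAfter d z ≡ d → evenFloor (length z) ≡ length z
evenFloor-directionAfter d []          _ = refl
evenFloor-directionAfter d (x ∷ [])    e = ⊥-elim (not-¬ refl (sym e))
evenFloor-directionAfter d (x ∷ y ∷ z) e =
  cong (2 +_) (evenFloor-directionAfter d z (trans (cong (λ b → directionAfter b z) (sym (not-involutive d))) e))

asAroundMax : List ℕ → List ℕ → ℕ
asAroundMax u v = evenFloor (as u) + suc (asUp v)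

altDown-max∷ : ∀ {m} z → All (_< m) z → T (altUp z) → T (altDown (m ∷ z))
altDown-max∷         []      _         _ = _
altDown-max∷ {m} (y ∷ z) (y<m ∷ _) p = alternating-∷∷⁺ true m y z (<⇒<ᵇ y<m) p

altDown-evenPrefix-++ : ∀ {m z₂} z → T (altDown z) → All (_< m) z → T (altDown (m ∷ z₂)) →
                        T (altDown (evenPrefix z ++ m ∷ z₂))
altDown-evenPrefix-++ []       _ _ q = q
altDown-evenPrefix-++ (x ∷ []) _ _ q = q
altDown-evenPrefix-++ {m} {z₂} (x ∷ y ∷ z) p (_ ∷ y<m ∷ z<m) q =
  let x>y , p′ = alternating-∷∷⁻ true x y z p in
  alternating-∷∷⁺ true x y (evenPrefix z ++ m ∷ z₂) x>y (ascent z p′ z<m)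
  where
  ascent : ∀ z → T (altUp (y ∷ z)) → All (_< m) z → T (altUp (y ∷ evenPrefix z ++ m ∷ z₂))
  ascent []             _ _ = alternating-∷∷⁺ false y m z₂ (<⇒<ᵇ y<m) q
  ascent (x′ ∷ [])      _ _ = alternating-∷∷⁺ false y m z₂ (<⇒<ᵇ y<m) q
  ascent (x′ ∷ y′ ∷ z′) r z<m =
    let y<x′ , r′ = alternating-∷∷⁻ false y x′ (y′ ∷ z′) r in
    alternating-∷∷⁺ false y x′ (y′ ∷ evenPrefix z′ ++ m ∷ z₂) y<x′
      (altDown-evenPrefix-++ (x′ ∷ y′ ∷ z′) r′ z<m q)

altDown⇒length≤1+asUp : ∀ {z x v} → T (altDown z) → z ⊆ x ∷ v → length z ≤ suc (asUp v)
altDown⇒length≤1+asUp {[]}    _ _ = z≤n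
altDown⇒length≤1+asUp {y ∷ z} {v = v} p s =
  s≤s (maxLength-upper altUp v (∷⁻ s) (alternating-tail true y z p))

module _ {u v : List ℕ} {m : ℕ} (u<m : All (_< m) u) where

  private
    bound = asAroundMax u v

    split-bound : ∀ {d} z₁ z₂ → z₁ ⊆ u → z₂ ⊆ m ∷ v → T (altDown (z₁ ++ z₂)) →
                  T (altDown z₁) → T (alternating d z₂) → directionAfter true z₁ ≡ d →
                  length z₁ + length z₂ ≤ bound
    split-bound {true} z₁ z₂ s₁ s₂ _ p₁ p₂ e = +-mono-≤
      (subst (_≤ evenFloor (as u)) (evenFloor-directionAfter true z₁ e)
        (evenFloor-mono-≤ (maxLength-upper altDown u s₁ p₁)))
      (altDown⇒length≤1+asUp p₂ s₂)
    split-bound {false} []       _  _  (refl ∷ _) _ _  _  ()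
    split-bound {false} (y ∷ z₁) _  s₁ (refl ∷ _) p _  _  e =
      ⊥-elim (not-¬ refl (trans (sym (directionAfter-max true y z₁ m _ p (All-resp-⊆ s₁ u<m))) e))
    split-bound {false} z₁       z₂ s₁ (_ ∷ʳ s₂)  _ p₁ p₂ _ =
      subst (length z₁ + length z₂ ≤_) (sym (+-suc _ _)) (+-mono-≤
        (≤-trans (maxLength-upper altDown u s₁ p₁) (n≤1+evenFloor[n] (as u)))
        (maxLength-upper altUp v s₂ p₂))

  as-++-max-upper : as (u ++ m ∷ v) ≤ bound
  as-++-max-upper = maxLength-least altDown (u ++ m ∷ v) bounded
    where
    bounded : ∀ {z} → z ⊆ u ++ m ∷ v → T (altDown z) → length z ≤ bound
    bounded s p with ⊆-++⁻ u (m ∷ v) s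
    ... | z₁ , z₂ , refl , s₁ , s₂ = let p₁ , p₂ = alternating-++⁻ true z₁ z₂ p in
      subst (_≤ bound) (sym (length-++ z₁)) (split-bound z₁ z₂ s₁ s₂ p p₁ p₂ refl)

  as-++-max-lower : All (_< m) v → bound ≤ as (u ++ m ∷ v)
  as-++-max-lower v<m with maxLength-attained altDown _ u | maxLength-attained altUp _ v
  ... | z₁ , s₁ , p₁ , e₁ | z₂ , s₂ , p₂ , e₂ = begin
    asAroundMax u v                          ≡⟨ cong₂ (λ a b → evenFloor a + suc b) e₁ e₂ ⟨
    evenFloor (length z₁) + suc (length z₂)  ≡⟨ cong (_+ suc (length z₂)) (length-evenPrefix z₁) ⟨
    length (evenPrefix z₁) + length (m ∷ z₂) ≡⟨ length-++ (evenPrefix z₁) ⟨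
    length (evenPrefix z₁ ++ m ∷ z₂)         ≤⟨ maxLength-upper altDown (u ++ m ∷ v) sub alt ⟩
    as (u ++ m ∷ v)                          ∎
    where
    open ≤-Reasoning
    sub : evenPrefix z₁ ++ m ∷ z₂ ⊆ u ++ m ∷ v
    sub = ++⁺ (⊆-trans (evenPrefix-⊆ z₁) s₁) (refl ∷ s₂)
    alt : T (altDown (evenPrefix z₁ ++ m ∷ z₂))
    alt = altDown-evenPrefix-++ z₁ p₁ (All-resp-⊆ s₁ u<m) (altDown-max∷ z₂ (All-resp-⊆ s₂ v<m) p₂)

as-++-max : ∀ {u m v} → All (_< m) u → All (_< m) v → as (u ++ m ∷ v) ≡ asAroundMax u v
as-++-max u<m v<m = ≤-antisym (as-++-max-upper u<m) (as-++-max-lower u<m v<m)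

-- Relabelling letters

OrderPreservingOn : (ℕ → ℕ) → List ℕ → Set
OrderPreservingOn g z = ∀ {x y} → x ∈ z → y ∈ z → (g x <ᵇ g y) ≡ (x <ᵇ y)

OrderReversingOn : (ℕ → ℕ) → List ℕ → Set
OrderReversingOn g z = ∀ {x y} → x ∈ z → y ∈ z → (g x <ᵇ g y) ≡ (y <ᵇ x)

alternating-map-preserving : ∀ d g z → OrderPreservingOn g z →
                             alternating d (map g z) ≡ alternating d z
alternating-map-preserving d     g []          _ = refl
alternating-map-preserving true  g (x ∷ [])    _ = refl
alternating-map-preserving false g (x ∷ [])    _ = refl
alternating-map-preserving d     g (x ∷ y ∷ z) g↑ = begin
  alternating d (g x ∷ g y ∷ map g z)
    ≡⟨ alternating-∷∷ d (g x) (g y) (map g z) ⟩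
  step d (g x) (g y) ∧ alternating (not d) (g y ∷ map g z)
    ≡⟨ cong₂ _∧_ (step-g d) (alternating-map-preserving (not d) g (y ∷ z) λ x∈ y∈ → g↑ (there x∈) (there y∈)) ⟩
  step d x y ∧ alternating (not d) (y ∷ z)
    ≡⟨ alternating-∷∷ d x y z ⟨
  alternating d (x ∷ y ∷ z)
    ∎
  where
  open ≡-Reasoning
  step-g : ∀ d → step d (g x) (g y) ≡ step d x y
  step-g true  = g↑ (there (here refl)) (here refl)
  step-g false = g↑ (here refl) (there (here refl))

alternating-map-reversing : ∀ d g z → OrderReversingOn g z →
                            alternating d (map g z) ≡ alternating (not d) z
alternating-map-reversing true  g []          _ = refl
alternating-map-reversing false g []          _ = refl
alternating-map-reversing true  g (x ∷ [])    _ = refl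
alternating-map-reversing false g (x ∷ [])    _ = refl
alternating-map-reversing d     g (x ∷ y ∷ z) g↓ = begin
  alternating d (g x ∷ g y ∷ map g z)
    ≡⟨ alternating-∷∷ d (g x) (g y) (map g z) ⟩
  step d (g x) (g y) ∧ alternating (not d) (g y ∷ map g z)
    ≡⟨ cong₂ _∧_ (step-g d) (alternating-map-reversing (not d) g (y ∷ z) λ x∈ y∈ → g↓ (there x∈) (there y∈)) ⟩
  step (not d) x y ∧ alternating (not (not d)) (y ∷ z)
    ≡⟨ alternating-∷∷ (not d) x y z ⟨
  alternating (not d) (x ∷ y ∷ z)
    ∎
  where
  open ≡-Reasoning
  step-g : ∀ d → step d (g x) (g y) ≡ step (not d) x y
  step-g true  = g↓ (there (here refl)) (here refl)
  step-g false = g↓ (here refl) (there (here refl))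

subseqs-map : ∀ g w → subseqs (map g w) ≡ map (map g) (subseqs w)
subseqs-map g []      = refl
subseqs-map g (x ∷ w) = begin
  map (g x ∷_) (subseqs (map g w)) ++ subseqs (map g w)
    ≡⟨ cong (λ S → map (g x ∷_) S ++ S) (subseqs-map g w) ⟩
  map (g x ∷_) (map (map g) (subseqs w)) ++ map (map g) (subseqs w)
    ≡⟨ cong (_++ map (map g) (subseqs w)) (trans (sym (map-∘ (subseqs w))) (map-∘ (subseqs w))) ⟩
  map (map g) (map (x ∷_) (subseqs w)) ++ map (map g) (subseqs w)
    ≡⟨ map-++ (map g) (map (x ∷_) (subseqs w)) (subseqs w) ⟨
  map (map g) (map (x ∷_) (subseqs w) ++ subseqs w)
    ∎
  where open ≡-Reasoning

maxLength-map : ∀ P Q g w → (∀ {z} → z ⊆ w → P (map g z) ≡ Q z) → maxLength P (map g w) ≡ maxLength Q w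
maxLength-map P Q g w PQ = cong (foldr _⊔_ 0) (begin
  map length (filterᵇ P (subseqs (map g w)))
    ≡⟨ cong (λ S → map length (filterᵇ P S)) (subseqs-map g w) ⟩
  map length (filterᵇ P (map (map g) (subseqs w)))
    ≡⟨ cong (map length) (filterᵇ-map P (map g) (subseqs w)) ⟩
  map length (map (map g) (filterᵇ (P ∘ map g) (subseqs w)))
    ≡⟨ map-∘ (filterᵇ (P ∘ map g) (subseqs w)) ⟨
  map (length ∘ map g) (filterᵇ (P ∘ map g) (subseqs w))
    ≡⟨ map-cong (length-map g) _ ⟩
  map length (filterᵇ (P ∘ map g) (subseqs w))
    ≡⟨ cong (map length) (filterᵇ-cong (All.tabulate (λ z∈ → PQ (∈-subseqs⇒⊆ w z∈)))) ⟩
  map length (filterᵇ Q (subseqs w))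
    ∎)
  where open ≡-Reasoning

module _ {w z : List ℕ} (z⊆w : z ⊆ w) (g : ℕ → ℕ) where

  ⊆-preserving : OrderPreservingOn g w → OrderPreservingOn g z
  ⊆-preserving g↑ x∈ y∈ = g↑ (Any-resp-⊆ z⊆w x∈) (Any-resp-⊆ z⊆w y∈)

  ⊆-reversing : OrderReversingOn g w → OrderReversingOn g z
  ⊆-reversing g↓ x∈ y∈ = g↓ (Any-resp-⊆ z⊆w x∈) (Any-resp-⊆ z⊆w y∈)

as-map-preserving : ∀ g w → OrderPreservingOn g w → as (map g w) ≡ as w
as-map-preserving g w g↑ =
  maxLength-map altDown altDown g w λ s → alternating-map-preserving true g _ (⊆-preserving s g g↑)

asUp-map-preserving : ∀ g w → OrderPreservingOn g w → asUp (map g w) ≡ asUp w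
asUp-map-preserving g w g↑ =
  maxLength-map altUp altUp g w λ s → alternating-map-preserving false g _ (⊆-preserving s g g↑)

as-map-reversing : ∀ g w → OrderReversingOn g w → as (map g w) ≡ asUp w
as-map-reversing g w g↓ =
  maxLength-map altDown altUp g w λ s → alternating-map-reversing true g _ (⊆-reversing s g g↓)

insert : ℕ → ℕ → List ℕ → List ℕ
insert zero    m w       = m ∷ w
insert (suc i) m []      = m ∷ []
insert (suc i) m (x ∷ w) = x ∷ insert i m w

take-insert-≤ : ∀ {i j} m w → i ≤ j → take (suc j) (insert i m w) ≡ insert i m (take j w)
take-insert-≤ {zero}        m w       _         = refl
take-insert-≤ {suc i} {suc j} m []      _         = refl
take-insert-≤ {suc i} {suc j} m (x ∷ w) (s≤s i≤j) = cong (x ∷_) (take-insert-≤ m w i≤j)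

drop-insert-≤ : ∀ {i j} m w → i ≤ j → drop (suc j) (insert i m w) ≡ drop j w
drop-insert-≤ {zero}        m w       _         = refl
drop-insert-≤ {suc i} {suc j} m []      _         = refl
drop-insert-≤ {suc i} {suc j} m (x ∷ w) (s≤s i≤j) = drop-insert-≤ m w i≤j

take-insert-+ : ∀ j i m w → j ≤ length w → take j (insert (j + i) m w) ≡ take j w
take-insert-+ zero    i m w       _         = refl
take-insert-+ (suc j) i m (x ∷ w) (s≤s j≤) = cong (x ∷_) (take-insert-+ j i m w j≤)

drop-insert-+ : ∀ j i m w → j ≤ length w → drop j (insert (j + i) m w) ≡ insert i m (drop j w)
drop-insert-+ zero    i m w       _         = refl
drop-insert-+ (suc j) i m (x ∷ w) (s≤s j≤) = drop-insert-+ j i m w j≤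

insert-≡-++ : ∀ i m w → insert i m w ≡ take i w ++ m ∷ drop i w
insert-≡-++ zero    m w       = refl
insert-≡-++ (suc i) m []      = refl
insert-≡-++ (suc i) m (x ∷ w) = cong (x ∷_) (insert-≡-++ i m w)

map-insert : ∀ (f : ℕ → ℕ) i m w → map f (insert i m w) ≡ insert i (f m) (map f w)
map-insert f zero    m w       = refl
map-insert f (suc i) m []      = refl
map-insert f (suc i) m (x ∷ w) = cong (f x ∷_) (map-insert f i m w)

∈-insert⁻ : ∀ {x} i m w → x ∈ insert i m w → x ≡ m ⊎ x ∈ w
∈-insert⁻ zero    m w       (here x≡m)  = inj₁ x≡m
∈-insert⁻ zero    m w       (there x∈)  = inj₂ x∈
∈-insert⁻ (suc i) m []      (here x≡m)  = inj₁ x≡m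
∈-insert⁻ (suc i) m (y ∷ w) (here x≡y)  = inj₂ (here x≡y)
∈-insert⁻ (suc i) m (y ∷ w) (there x∈) with ∈-insert⁻ i m w x∈
... | inj₁ x≡m = inj₁ x≡m
... | inj₂ x∈w = inj₂ (there x∈w)

All-insert : ∀ {P : ℕ → Set} i m w → P m → All P w → All P (insert i m w)
All-insert zero    m w       Pm Pw          = Pm ∷ Pw
All-insert (suc i) m []      Pm []          = Pm ∷ []
All-insert (suc i) m (x ∷ w) Pm (Px ∷ Pw) = Px ∷ All-insert i m w Pm Pw

remove : ℕ → List ℕ → List ℕ
remove y = filterᵇ (λ x → not (y ≡ᵇ x))

distinctWords : List ℕ → ℕ → List (List ℕ)
distinctWords Y ℓ = filterᵇ distinct (wordsOver Y ℓ)

elem⇒∈ : ∀ {x} xs → T (elem x xs) → x ∈ xs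
elem⇒∈ {x} (y ∷ xs) p with Equivalence.to T-∨ p
... | inj₁ x≡y = here (≡ᵇ⇒≡ x y x≡y)
... | inj₂ p′  = there (elem⇒∈ xs p′)

∈⇒elem : ∀ {x xs} → x ∈ xs → T (elem x xs)
∈⇒elem {x} (here refl) = Equivalence.from T-∨ (inj₁ (≡ᵇ-refl x))
∈⇒elem     (there x∈)  = Equivalence.from T-∨ (inj₂ (∈⇒elem x∈))

distinct-∷⁻ : ∀ {x xs} → T (distinct (x ∷ xs)) → x ∉ xs × T (distinct xs)
distinct-∷⁻ {x} {xs} p with Equivalence.to (T-∧ {not (elem x xs)}) p
... | x∉ , q = (λ x∈ → T-not⇒¬T x∉ (∈⇒elem x∈)) , q

distinct-∷⁺ : ∀ {x xs} → x ∉ xs → T (distinct xs) → T (distinct (x ∷ xs))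
distinct-∷⁺ {x} {xs} x∉ q = Equivalence.from (T-∧ {not (elem x xs)}) (¬T⇒T-not (x∉ ∘ elem⇒∈ xs) , q)

distinct-filterᵇ : ∀ (p : ℕ → Bool) xs → T (distinct xs) → T (distinct (filterᵇ p xs))
distinct-filterᵇ p []       _ = _
distinct-filterᵇ p (x ∷ xs) d with distinct-∷⁻ {x} {xs} d | p x
... | _  , d′ | false = distinct-filterᵇ p xs d′
... | x∉ , d′ | true  = distinct-∷⁺ (x∉ ∘ proj₁ ∘ ∈-filter⁻ (T? ∘ p)) (distinct-filterᵇ p xs d′)

∈-remove⁺ : ∀ {m y Y} → m ∈ Y → m ≢ y → m ∈ remove y Y
∈-remove⁺ {m} {y} m∈ m≢y = ∈-filter⁺ (T? ∘ λ x → not (y ≡ᵇ x)) m∈ (≢⇒T-not-≡ᵇ (m≢y ∘ sym))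

∈-remove⁻ : ∀ {x y Y} → x ∈ remove y Y → x ∈ Y × y ≢ x
∈-remove⁻ {x} {y} x∈ with ∈-filter⁻ (T? ∘ λ z → not (y ≡ᵇ z)) x∈
... | x∈Y , y≢x = x∈Y , λ y≡x → T-not⇒¬T y≢x (≡⇒≡ᵇ y x y≡x)

remove-∷-≡ : ∀ x X → remove x (x ∷ X) ≡ remove x X
remove-∷-≡ x X = filter-reject (T? ∘ λ z → not (x ≡ᵇ z)) (λ p → T-not⇒¬T p (≡ᵇ-refl x))

remove-∷-≢ : ∀ {y x} X → y ≢ x → remove y (x ∷ X) ≡ x ∷ remove y X
remove-∷-≢ {y} X y≢x = filter-accept (T? ∘ λ z → not (y ≡ᵇ z)) (≢⇒T-not-≡ᵇ y≢x)

remove-∉ : ∀ {m} Y → m ∉ Y → remove m Y ≡ Y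
remove-∉ {m} Y m∉ =
  filter-all (T? ∘ λ x → not (m ≡ᵇ x)) (All.tabulate (λ {x} x∈ → ≢⇒T-not-≡ᵇ {m} {x} λ { refl → m∉ x∈ }))

remove-comm : ∀ x y Y → remove x (remove y Y) ≡ remove y (remove x Y)
remove-comm x y = filterᵇ-comm (λ z → not (x ≡ᵇ z)) (λ z → not (y ≡ᵇ z))

length-remove : ∀ {y X} → y ∈ X → length (remove y X) < length X
length-remove {y} y∈ =
  filter-notAll (T? ∘ λ x → not (y ≡ᵇ x)) _ (Any.map (λ { refl p → T-not⇒¬T p (≡ᵇ-refl y) }) y∈)

∑-remove : ∀ {m} Y (f : ℕ → ℕ) → T (distinct Y) → m ∈ Y → ∑ Y f ≡ f m + ∑ (remove m Y) f
∑-remove {m} (x ∷ Y) f d m∈ with m ≟ x | distinct-∷⁻ {x} {Y} d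
... | yes refl | x∉ , _ = cong (λ Z → f x + ∑ Z f) (sym (trans (remove-∷-≡ x Y) (remove-∉ Y x∉)))
... | no m≢x   | _ , d′ with m∈
...   | here m≡x  = ⊥-elim (m≢x m≡x)
...   | there m∈Y = begin
  f x + ∑ Y f                     ≡⟨ cong (f x +_) (∑-remove Y f d′ m∈Y) ⟩
  f x + (f m + ∑ (remove m Y) f)  ≡⟨ +-exchange (f x) (f m) _ ⟩
  f m + (f x + ∑ (remove m Y) f)  ≡⟨ cong (λ Z → f m + ∑ Z f) (remove-∷-≢ Y m≢x) ⟨
  f m + ∑ (remove m (x ∷ Y)) f    ∎
  where open ≡-Reasoning

filterᵇ-∌-map-∷ : ∀ y x W → filterᵇ (λ w → not (elem y w)) (map (x ∷_) W) ≡
                  (if y ≡ᵇ x then [] else map (x ∷_) (filterᵇ (λ w → not (elem y w)) W))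
filterᵇ-∌-map-∷ y x W rewrite filterᵇ-map (λ w → not (elem y w)) (x ∷_) W with y ≡ᵇ x
... | true  = cong (map (x ∷_)) (filterᵇ-false W)
... | false = refl

wordsOver-remove : ∀ y Y ℓ → filterᵇ (λ w → not (elem y w)) (wordsOver Y ℓ) ≡ wordsOver (remove y Y) ℓ
wordsOver-remove y Y zero    = refl
wordsOver-remove y Y (suc ℓ) = trans (filterᵇ-concatMap _ (λ x → map (x ∷_) (wordsOver Y ℓ)) Y) (go Y)
  where
  go : ∀ X → concatMap (λ x → filterᵇ (λ w → not (elem y w)) (map (x ∷_) (wordsOver Y ℓ))) X ≡
             concatMap (λ x → map (x ∷_) (wordsOver (remove y Y) ℓ)) (remove y X)
  go []      = refl
  go (x ∷ X) rewrite filterᵇ-∌-map-∷ y x (wordsOver Y ℓ) with y ≡ᵇ x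
  ... | true  = go X
  ... | false = cong₂ _++_ (cong (map (x ∷_)) (wordsOver-remove y Y ℓ)) (go X)

distinctWords-suc : ∀ Y ℓ →
  distinctWords Y (suc ℓ) ≡ concatMap (λ y → map (y ∷_) (distinctWords (remove y Y) ℓ)) Y
distinctWords-suc Y ℓ =
  trans (filterᵇ-concatMap distinct (λ x → map (x ∷_) (wordsOver Y ℓ)) Y) (concatMap-cong first Y)
  where
  open ≡-Reasoning
  first : ∀ x → filterᵇ distinct (map (x ∷_) (wordsOver Y ℓ)) ≡ map (x ∷_) (distinctWords (remove x Y) ℓ)
  first x = begin
    filterᵇ distinct (map (x ∷_) (wordsOver Y ℓ))
      ≡⟨ filterᵇ-map distinct (x ∷_) (wordsOver Y ℓ) ⟩
    map (x ∷_) (filterᵇ (λ w → not (elem x w) ∧ distinct w) (wordsOver Y ℓ))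
      ≡⟨ cong (map (x ∷_)) (filterᵇ-∧ (λ w → not (elem x w)) distinct (wordsOver Y ℓ)) ⟩
    map (x ∷_) (filterᵇ distinct (filterᵇ (λ w → not (elem x w)) (wordsOver Y ℓ)))
      ≡⟨ cong (map (x ∷_) ∘ filterᵇ distinct) (wordsOver-remove x Y ℓ) ⟩
    map (x ∷_) (distinctWords (remove x Y) ℓ)
      ∎

∑-distinctWords-suc : ∀ Y ℓ h →
  ∑ (distinctWords Y (suc ℓ)) h ≡ ∑[ y ∈ Y ] ∑[ w ∈ distinctWords (remove y Y) ℓ ] h (y ∷ w)
∑-distinctWords-suc Y ℓ h = begin
  ∑ (distinctWords Y (suc ℓ)) h
    ≡⟨ cong (λ L → ∑ L h) (distinctWords-suc Y ℓ) ⟩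
  ∑ (concatMap (λ y → map (y ∷_) (distinctWords (remove y Y) ℓ)) Y) h
    ≡⟨ ∑-concatMap _ Y h ⟩
  ∑[ y ∈ Y ] ∑ (map (y ∷_) (distinctWords (remove y Y) ℓ)) h
    ≡⟨ ∑-cong Y (λ y → ∑-map (y ∷_) (distinctWords (remove y Y) ℓ) h) ⟩
  ∑[ y ∈ Y ] ∑[ w ∈ distinctWords (remove y Y) ℓ ] h (y ∷ w)
    ∎
  where open ≡-Reasoning

distinctWords-tooLong : ∀ X ℓ → length X < ℓ → distinctWords X ℓ ≡ []
distinctWords-tooLong X (suc ℓ) |X|≤ℓ = trans (distinctWords-suc X ℓ) (go X (All.tabulate id))
  where
  go : ∀ Y → All (_∈ X) Y → concatMap (λ y → map (y ∷_) (distinctWords (remove y X) ℓ)) Y ≡ []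
  go []      []          = refl
  go (y ∷ Y) (y∈ ∷ Y⊆X) = cong₂ (λ L L′ → map (y ∷_) L ++ L′)
    (distinctWords-tooLong (remove y X) ℓ (<-≤-trans (length-remove y∈) (≤-pred |X|≤ℓ))) (go Y Y⊆X)

∑-distinctWords-remove : ∀ m Y ℓ h →
  ∑[ y ∈ remove m Y ] ∑[ w ∈ distinctWords (remove m (remove y Y)) ℓ ] h (y ∷ w) ≡
  ∑ (distinctWords (remove m Y) (suc ℓ)) h
∑-distinctWords-remove m Y ℓ h = trans
  (∑-cong (remove m Y) (λ y → cong (λ Z → ∑[ w ∈ distinctWords Z ℓ ] h (y ∷ w)) (remove-comm m y Y)))
  (sym (∑-distinctWords-suc (remove m Y) ℓ h))

-- A word over Y either avoids the letter m or is obtained by inserting m into a word avoiding it.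
∑-distinctWords-insert : ∀ ℓ Y m h → T (distinct Y) → m ∈ Y →
  ∑ (distinctWords Y (suc ℓ)) h ≡
  ∑ (distinctWords (remove m Y) (suc ℓ)) h + ∑[ i < suc ℓ ] ∑[ w ∈ distinctWords (remove m Y) ℓ ] h (insert i m w)
∑-distinctWords-insert zero Y m h dY m∈ = begin
  ∑ (distinctWords Y 1) h                                 ≡⟨ ∑-distinctWords-suc Y 0 h ⟩
  ∑[ y ∈ Y ] (h [ y ] + 0)                                ≡⟨ ∑-remove Y _ dY m∈ ⟩
  (h [ m ] + 0) + ∑[ y ∈ remove m Y ] (h [ y ] + 0)       ≡⟨ +-comm (h [ m ] + 0) _ ⟩
  ∑[ y ∈ remove m Y ] (h [ y ] + 0) + (h [ m ] + 0)       ≡⟨ cong (∑ (remove m Y) (λ y → h [ y ] + 0) +_) (+-identityʳ _) ⟨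
  ∑[ y ∈ remove m Y ] (h [ y ] + 0) + (h [ m ] + 0 + 0)   ≡⟨ cong (_+ _) (∑-distinctWords-remove m Y 0 h) ⟩
  ∑ (distinctWords (remove m Y) 1) h + (h [ m ] + 0 + 0)  ∎
  where open ≡-Reasoning
∑-distinctWords-insert (suc ℓ) Y m h dY m∈ = begin
  ∑ (distinctWords Y (2 + ℓ)) h                         ≡⟨ ∑-distinctWords-suc Y (suc ℓ) h ⟩
  ∑[ y ∈ Y ] Φ y                                        ≡⟨ ∑-remove Y Φ dY m∈ ⟩
  Φ m + ∑[ y ∈ remove m Y ] Φ y                         ≡⟨ cong (Φ m +_) others ⟩
  Φ m + (∑ (D (2 + ℓ)) h + ∑[ i < suc ℓ ] ins (suc i))  ≡⟨ +-exchange (Φ m) (∑ (D (2 + ℓ)) h) _ ⟩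
  ∑ (D (2 + ℓ)) h + ∑[ i < 2 + ℓ ] ins i                ∎
  where
  open ≡-Reasoning
  D : ℕ → List (List ℕ)
  D = distinctWords (remove m Y)
  Φ : ℕ → ℕ
  Φ y = ∑[ w ∈ distinctWords (remove y Y) (suc ℓ) ] h (y ∷ w)
  ins : ℕ → ℕ
  ins i = ∑[ w ∈ D (suc ℓ) ] h (insert i m w)
  Φ′ : ℕ → ℕ
  Φ′ y = ∑[ w ∈ distinctWords (remove m (remove y Y)) (suc ℓ) ] h (y ∷ w)
  Ψ : ℕ → ℕ → ℕ
  Ψ i y = ∑[ w ∈ distinctWords (remove m (remove y Y)) ℓ ] h (y ∷ insert i m w)
  split : ∀ {y} → y ∈ remove m Y → Φ y ≡ Φ′ y + ∑[ i < suc ℓ ] Ψ i y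
  split {y} y∈ with ∈-remove⁻ {Y = Y} y∈
  ... | _ , m≢y =
    ∑-distinctWords-insert ℓ (remove y Y) m (h ∘ (y ∷_)) (distinct-filterᵇ _ Y dY) (∈-remove⁺ m∈ m≢y)
  others : ∑[ y ∈ remove m Y ] Φ y ≡ ∑ (D (2 + ℓ)) h + ∑[ i < suc ℓ ] ins (suc i)
  others = begin
    ∑[ y ∈ remove m Y ] Φ y
      ≡⟨ ∑-cong-All (All.tabulate split) ⟩
    ∑[ y ∈ remove m Y ] (Φ′ y + ∑[ i < suc ℓ ] Ψ i y)
      ≡⟨ ∑-distrib-+ (remove m Y) Φ′ _ ⟩
    ∑ (remove m Y) Φ′ + ∑[ y ∈ remove m Y ] ∑[ i < suc ℓ ] Ψ i y
      ≡⟨ cong₂ _+_ (∑-distinctWords-remove m Y (suc ℓ) h) (sym (∑<-∑-comm (suc ℓ) (remove m Y) Ψ)) ⟩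
    ∑ (D (2 + ℓ)) h + ∑[ i < suc ℓ ] ∑ (remove m Y) (Ψ i)
      ≡⟨ cong (∑ (D (2 + ℓ)) h +_) (∑<-cong′ (suc ℓ) λ i → ∑-distinctWords-remove m Y ℓ (h ∘ insert (suc i) m)) ⟩
    ∑ (D (2 + ℓ)) h + ∑[ i < suc ℓ ] ins (suc i)
      ∎

distinct-applyUpTo : ∀ f n → f Preserves _<_ ⟶ _<_ → T (distinct (applyUpTo f n))
distinct-applyUpTo f zero    _  = _
distinct-applyUpTo f (suc n) f↑ = distinct-∷⁺ f0∉ (distinct-applyUpTo (f ∘ suc) n (f↑ ∘ s<s))
  where
  f0∉ : f 0 ∉ applyUpTo (f ∘ suc) n
  f0∉ f0∈ with ∈-applyUpTo⁻ (f ∘ suc) f0∈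
  ... | _ , _ , e = <-irrefl e (f↑ z<s)

remove-applyUpTo-last : ∀ f n → f Preserves _<_ ⟶ _<_ → remove (f n) (applyUpTo f (suc n)) ≡ applyUpTo f n
remove-applyUpTo-last f zero    _  = remove-∷-≡ (f 0) []
remove-applyUpTo-last f (suc n) f↑ = trans (remove-∷-≢ _ (λ e → <-irrefl (sym e) (f↑ z<s)))
                                           (cong (f 0 ∷_) (remove-applyUpTo-last (f ∘ suc) n (f↑ ∘ s<s)))

∑-perms-suc : ∀ n h → ∑ (perms (suc n)) h ≡ ∑[ i < suc n ] ∑[ w ∈ perms n ] h (insert i (suc n) w)
∑-perms-suc n h = begin
  ∑ (perms (suc n)) h
    ≡⟨ ∑-distinctWords-insert n Yₙ₊₁ (suc n) h (distinct-applyUpTo suc (suc n) s<s)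
                                                (∈-applyUpTo⁺ suc ≤-refl) ⟩
  ∑ (distinctWords (remove (suc n) Yₙ₊₁) (suc n)) h + insertions (remove (suc n) Yₙ₊₁)
    ≡⟨ cong (λ Y → ∑ (distinctWords Y (suc n)) h + insertions Y) (remove-applyUpTo-last suc n s<s) ⟩
  ∑ (distinctWords Yₙ (suc n)) h + insertions Yₙ
    ≡⟨ cong (λ L → ∑ L h + insertions Yₙ)
            (distinctWords-tooLong Yₙ (suc n) (≤-reflexive (cong suc (length-applyUpTo suc n)))) ⟩
  insertions Yₙ
    ∎
  where
  open ≡-Reasoning
  Yₙ Yₙ₊₁ : List ℕ
  Yₙ   = applyUpTo suc n
  Yₙ₊₁ = applyUpTo suc (suc n)
  insertions : List ℕ → ℕ
  insertions Y = ∑[ i < suc n ] ∑[ w ∈ distinctWords Y n ] h (insert i (suc n) w)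

wordsOver-All : ∀ {P : ℕ → Set} Y ℓ → All P Y → All (λ w → All P w × length w ≡ ℓ) (wordsOver Y ℓ)
wordsOver-All Y zero    _  = ([] , refl) ∷ []
wordsOver-All {P} Y (suc ℓ) PY = All.concat⁺ (All.map⁺ (go Y PY))
  where
  go : ∀ X → All P X → All (λ x → All (λ w → All P w × length w ≡ suc ℓ) (map (x ∷_) (wordsOver Y ℓ))) X
  go []      []          = []
  go (x ∷ X) (Px ∷ PX) =
    All.map⁺ (All.map (λ (Pw , |w|≡ℓ) → (Px ∷ Pw) , cong suc |w|≡ℓ) (wordsOver-All Y ℓ PY)) ∷ go X PX

applyUpTo-suc-≤ : ∀ n → All (_≤ n) (applyUpTo suc n)
applyUpTo-suc-≤ n = All.tabulate bounded
  where
  bounded : ∀ {x} → x ∈ applyUpTo suc n → x ≤ n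
  bounded x∈ with ∈-applyUpTo⁻ suc x∈
  ... | _ , i<n , refl = i<n

perms-bounded : ∀ n → All (λ w → All (_≤ n) w × length w ≡ n) (perms n)
perms-bounded n = All.filter⁺ (T? ∘ distinct) (wordsOver-All _ n (applyUpTo-suc-≤ n))

-- Complementation x ↦ N + 1 - x

complement : ℕ → ℕ → ℕ
complement N x = suc N ∸ x

InjectiveOn : (ℕ → ℕ) → List ℕ → Set
InjectiveOn g Y = ∀ {x y} → x ∈ Y → y ∈ Y → g x ≡ g y → x ≡ y

≡ᵇ-injective : ∀ {g : ℕ → ℕ} {x y} → (g x ≡ g y → x ≡ y) → (g x ≡ᵇ g y) ≡ (x ≡ᵇ y)
≡ᵇ-injective {g} {x} {y} inj with x ≟ y
... | yes refl = trans (Equivalence.to T-≡ (≡ᵇ-refl (g x))) (sym (Equivalence.to T-≡ (≡ᵇ-refl x)))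
... | no x≢y   = trans (¬T⇒≡false (x≢y ∘ inj ∘ ≡ᵇ⇒≡ _ _)) (sym (¬T⇒≡false (x≢y ∘ ≡ᵇ⇒≡ _ _)))

distinct-map : ∀ g w → InjectiveOn g w → distinct (map g w) ≡ distinct w
distinct-map g []      _   = refl
distinct-map g (x ∷ w) inj = cong₂ (λ b c → not b ∧ c)
  (elem-map w (λ y∈ → inj (here refl) (there y∈))) (distinct-map g w (λ x∈ y∈ → inj (there x∈) (there y∈)))
  where
  elem-map : ∀ v → (∀ {y} → y ∈ v → g x ≡ g y → x ≡ y) → elem (g x) (map g v) ≡ elem x v
  elem-map []      _    = refl
  elem-map (y ∷ v) injx = cong₂ _∨_ (≡ᵇ-injective (injx (here refl))) (elem-map v (injx ∘ there))

wordsOver-map : ∀ (f : ℕ → ℕ) Y ℓ → wordsOver (map f Y) ℓ ≡ map (map f) (wordsOver Y ℓ)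
wordsOver-map f Y zero    = refl
wordsOver-map f Y (suc ℓ) = go Y
  where
  W = wordsOver Y ℓ
  go : ∀ X → concatMap (λ x → map (x ∷_) (wordsOver (map f Y) ℓ)) (map f X) ≡
             map (map f) (concatMap (λ x → map (x ∷_) W) X)
  go []      = refl
  go (x ∷ X) = begin
    map (f x ∷_) (wordsOver (map f Y) ℓ) ++ _  ≡⟨ cong₂ _++_ (cong (map (f x ∷_)) (wordsOver-map f Y ℓ)) (go X) ⟩
    map (f x ∷_) (map (map f) W) ++ _          ≡⟨ cong (_++ _) (trans (sym (map-∘ W)) (map-∘ W)) ⟩
    map (map f) (map (x ∷_) W) ++ _            ≡⟨ map-++ (map f) (map (x ∷_) W) _ ⟨
    map (map f) (map (x ∷_) W ++ _)            ∎
    where open ≡-Reasoning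

distinctWords-map : ∀ g Y ℓ → InjectiveOn g Y → map (map g) (distinctWords Y ℓ) ≡ distinctWords (map g Y) ℓ
distinctWords-map g Y ℓ inj = sym (begin
  filterᵇ distinct (wordsOver (map g Y) ℓ)                  ≡⟨ cong (filterᵇ distinct) (wordsOver-map g Y ℓ) ⟩
  filterᵇ distinct (map (map g) (wordsOver Y ℓ))            ≡⟨ filterᵇ-map distinct (map g) (wordsOver Y ℓ) ⟩
  map (map g) (filterᵇ (distinct ∘ map g) (wordsOver Y ℓ))  ≡⟨ cong (map (map g)) (filterᵇ-cong injective) ⟩
  map (map g) (filterᵇ distinct (wordsOver Y ℓ))            ∎)
  where
  open ≡-Reasoning
  injective : All (λ w → distinct (map g w) ≡ distinct w) (wordsOver Y ℓ)
  injective = All.map (λ {w} (w⊆Y , _) → distinct-map g w λ x∈ y∈ → inj (All.lookup w⊆Y x∈) (All.lookup w⊆Y y∈))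
                      (wordsOver-All Y ℓ (All.tabulate id))

concatMap-↭-pointwise : ∀ {f g : A → List B} xs → (∀ x → f x ↭ g x) → concatMap f xs ↭ concatMap g xs
concatMap-↭-pointwise []       _   = ↭-refl
concatMap-↭-pointwise (x ∷ xs) f↭g = ↭-++⁺ (f↭g x) (concatMap-↭-pointwise xs f↭g)

concatMap-↭ : ∀ (f : A → List B) {xs ys} → xs ↭ ys → concatMap f xs ↭ concatMap f ys
concatMap-↭ f ↭.refl         = ↭-refl
concatMap-↭ f (↭.prep x p)   = ↭-++⁺ˡ (f x) (concatMap-↭ f p)
concatMap-↭ f (↭.swap x y p) = ↭-trans (↭-++⁺ˡ (f x) (↭-++⁺ˡ (f y) (concatMap-↭ f p))) (↭-shifts (f x) (f y))
concatMap-↭ f (↭.trans p q)  = ↭-trans (concatMap-↭ f p) (concatMap-↭ f q)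

wordsOver-↭ : ∀ {Y Y′} ℓ → Y ↭ Y′ → wordsOver Y ℓ ↭ wordsOver Y′ ℓ
wordsOver-↭ zero    _ = ↭-refl
wordsOver-↭ {Y} {Y′} (suc ℓ) p = ↭-trans
  (concatMap-↭-pointwise Y (λ x → ↭-map⁺ (x ∷_) (wordsOver-↭ ℓ p)))
  (concatMap-↭ (λ x → map (x ∷_) (wordsOver Y′ ℓ)) p)

applyDownFrom↭applyUpTo : ∀ (f : ℕ → A) n → applyDownFrom f n ↭ applyUpTo f n
applyDownFrom↭applyUpTo f zero    = ↭-refl
applyDownFrom↭applyUpTo f (suc n) = ↭-trans (↭-prep (f n) (applyDownFrom↭applyUpTo f n))
  (↭-trans (↭-∷↭∷ʳ (f n) (applyUpTo f n)) (↭-reflexive (applyUpTo-∷ʳ f n)))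

applyUpTo-∸ : ∀ N → applyUpTo (N ∸_) N ≡ applyDownFrom suc N
applyUpTo-∸ zero    = refl
applyUpTo-∸ (suc N) = cong (suc N ∷_) (applyUpTo-∸ N)

map-complement-↭ : ∀ N → map (complement N) (applyUpTo suc N) ↭ applyUpTo suc N
map-complement-↭ N = ↭-trans (↭-reflexive (trans (map-applyUpTo suc (complement N) N) (applyUpTo-∸ N)))
                              (applyDownFrom↭applyUpTo suc N)

complement-< : ∀ N {x y} → x < y → y ≤ N → complement N y < complement N x
complement-< N x<y y≤N = ∸-monoʳ-< x<y (m≤n⇒m≤1+n y≤N)

complement-reversing : ∀ N w → All (_≤ N) w → OrderReversingOn (complement N) w
complement-reversing N w w≤N {x} {y} x∈ y∈ with <-cmp x y
... | tri< x<y _ _  = trans (≮⇒<ᵇ≡false (<-asym (complement-< N x<y (All.lookup w≤N y∈))))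
                            (sym (≮⇒<ᵇ≡false (<-asym x<y)))
... | tri≈ _ refl _ = trans (≮⇒<ᵇ≡false {complement N x} (<-irrefl refl)) (sym (≮⇒<ᵇ≡false {x} (<-irrefl refl)))
... | tri> _ _ y<x  = trans (<⇒<ᵇ≡true (complement-< N y<x (All.lookup w≤N x∈))) (sym (<⇒<ᵇ≡true y<x))

complement-injective : ∀ N w → All (_≤ N) w → InjectiveOn (complement N) w
complement-injective N w w≤N x∈ y∈ =
  ∸-cancelˡ-≡ (m≤n⇒m≤1+n (All.lookup w≤N x∈)) (m≤n⇒m≤1+n (All.lookup w≤N y∈))

∑-perms-complement : ∀ N f → ∑[ w ∈ perms N ] f (map (complement N) w) ≡ ∑ (perms N) f
∑-perms-complement N f = begin
  ∑[ w ∈ perms N ] f (map (complement N) w)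
    ≡⟨ ∑-map (map (complement N)) (perms N) f ⟨
  ∑ (map (map (complement N)) (perms N)) f
    ≡⟨ cong (λ L → ∑ L f) (distinctWords-map (complement N) Y N (complement-injective N Y (applyUpTo-suc-≤ N))) ⟩
  ∑ (distinctWords (map (complement N) Y) N) f
    ≡⟨ ∑-↭ f (filter-↭ (T? ∘ distinct) (wordsOver-↭ N (map-complement-↭ N))) ⟩
  ∑ (perms N) f
    ∎
  where
  open ≡-Reasoning
  Y = applyUpTo suc N

count-asUp : ∀ N s → ∑[ q ∈ perms N ] ⟦ asUp q ≡ᵇ s ⟧ ≡ a s N
count-asUp N s = begin
  ∑[ q ∈ perms N ] ⟦ asUp q ≡ᵇ s ⟧
    ≡⟨ ∑-cong-All (All.map asUp≡as∘complement (perms-bounded N)) ⟩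
  ∑[ q ∈ perms N ] ⟦ as (map (complement N) q) ≡ᵇ s ⟧
    ≡⟨ ∑-perms-complement N (λ w → ⟦ as w ≡ᵇ s ⟧) ⟩
  ∑[ w ∈ perms N ] ⟦ as w ≡ᵇ s ⟧
    ≡⟨ length-filterᵇ (λ w → as w ≡ᵇ s) (perms N) ⟨
  a s N
    ∎
  where
  open ≡-Reasoning
  asUp≡as∘complement : ∀ {q} → All (_≤ N) q × length q ≡ N →
                       ⟦ asUp q ≡ᵇ s ⟧ ≡ ⟦ as (map (complement N) q) ≡ᵇ s ⟧
  asUp≡as∘complement {q} (q≤N , _) =
    cong (λ k → ⟦ k ≡ᵇ s ⟧) (sym (as-map-reversing (complement N) q (complement-reversing N q q≤N)))

-- Statistics depending only on the relative order of letters

RelabellingWithin : ℕ → (ℕ → ℕ) → List ℕ → Set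
RelabellingWithin N g w = All (_≤ N) w × All (_≤ N) (map g w) × OrderPreservingOn g w

-- The bound N leaves room for inserting a new largest letter N + 1, see PatternInvariant-insertˡ.
PatternInvariant : ℕ → (List ℕ → List ℕ → ℕ) → Set
PatternInvariant N F = ∀ u v g h → RelabellingWithin N g u → RelabellingWithin N h v → F (map g u) (map h v) ≡ F u v

PatternInvariant-swap : ∀ {N} F → PatternInvariant N F → PatternInvariant N (λ u v → F v u)
PatternInvariant-swap F inv u v g h ρᵤ ρᵥ = inv v u h g ρᵥ ρᵤ

extend : (ℕ → ℕ) → ℕ → ℕ → ℕ → ℕ
extend g m b x = if x ≡ᵇ m then b else g x

extend-< : ∀ g {m} b {x} → x < m → extend g m b x ≡ g x
extend-< g {m} b {x} x<m rewrite ¬T⇒≡false (<⇒≢ x<m ∘ ≡ᵇ⇒≡ x m) = refl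

extend-≡ : ∀ g m b → extend g m b m ≡ b
extend-≡ g m b rewrite Equivalence.to T-≡ (≡ᵇ-refl m) = refl

module _ {u : List ℕ} {g : ℕ → ℕ} {m b : ℕ} (u<m : All (_< m) u) where

  map-extend-insert : ∀ i → map (extend g m b) (insert i m u) ≡ insert i b (map g u)
  map-extend-insert i = trans (map-insert (extend g m b) i m u)
    (cong₂ (insert i) (extend-≡ g m b) (map-cong-local (All.map (extend-< g b) u<m)))

  extend-preserving : ∀ i → All (λ x → g x < b) u → OrderPreservingOn g u →
                      OrderPreservingOn (extend g m b) (insert i m u)
  extend-preserving i gu<b g↑ {x} {y} x∈ y∈ with ∈-insert⁻ i m u x∈ | ∈-insert⁻ i m u y∈
  ... | inj₂ x∈u | inj₂ y∈u
    rewrite extend-< g b (All.lookup u<m x∈u) | extend-< g b (All.lookup u<m y∈u) = g↑ x∈u y∈u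
  ... | inj₂ x∈u | inj₁ refl
    rewrite extend-< g b (All.lookup u<m x∈u) | extend-≡ g m b =
      trans (<⇒<ᵇ≡true (All.lookup gu<b x∈u)) (sym (<⇒<ᵇ≡true (All.lookup u<m x∈u)))
  ... | inj₁ refl | inj₂ y∈u
    rewrite extend-< g b (All.lookup u<m y∈u) | extend-≡ g m b =
      trans (≮⇒<ᵇ≡false (<-asym (All.lookup gu<b y∈u))) (sym (≮⇒<ᵇ≡false (<-asym (All.lookup u<m y∈u))))
  ... | inj₁ refl | inj₁ refl =
      trans (≮⇒<ᵇ≡false {extend g m b m} (<-irrefl refl)) (sym (≮⇒<ᵇ≡false {m} (<-irrefl refl)))

  extend-within : ∀ {N} i → m ≤ N → b ≤ N → All (λ x → g x < b) u → OrderPreservingOn g u →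
                  RelabellingWithin N (extend g m b) (insert i m u)
  extend-within i m≤N b≤N gu<b g↑ =
    All-insert i m u m≤N (All.map (λ x<m → <⇒≤ (<-≤-trans x<m m≤N)) u<m) ,
    subst (All (_≤ _)) (sym (map-extend-insert i))
      (All-insert i b (map g u) b≤N (All.map⁺ (All.map (λ gx<b → <⇒≤ (<-≤-trans gx<b b≤N)) gu<b))) ,
    extend-preserving i gu<b g↑

id-within : ∀ {N w} → All (_≤ N) w → RelabellingWithin N id w
id-within w≤N = w≤N , subst (All (_≤ _)) (sym (map-id _)) w≤N , λ _ _ → refl

PatternInvariant-insertˡ : ∀ n i F → PatternInvariant (suc n) F → PatternInvariant n (λ u v → F (insert i (suc n) u) v)
PatternInvariant-insertˡ n i F inv u v g h (u≤ , gu≤ , g↑) (v≤ , hv≤ , h↑) = begin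
  F (insert i (suc n) (map g u)) (map h v)   ≡⟨ cong (λ w → F w (map h v)) (map-extend-insert u<1+n i) ⟨
  F (map g′ (insert i (suc n) u)) (map h v)  ≡⟨ inv (insert i (suc n) u) v g′ h
                                                  (extend-within u<1+n i ≤-refl ≤-refl (All.map s≤s (All.map⁻ gu≤)) g↑)
                                                  (All.map m≤n⇒m≤1+n v≤ , All.map m≤n⇒m≤1+n hv≤ , h↑) ⟩
  F (insert i (suc n) u) v                   ∎
  where
  open ≡-Reasoning
  g′ = extend g (suc n) (suc n)
  u<1+n = All.map s≤s u≤

PatternInvariant-insertʳ : ∀ n i F → PatternInvariant (suc n) F → PatternInvariant n (λ u v → F u (insert i (suc n) v))
PatternInvariant-insertʳ n i F inv = PatternInvariant-swap (λ u v → F v (insert i (suc n) u))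
  (PatternInvariant-insertˡ n i (λ u v → F v u) (PatternInvariant-swap F inv))

PatternInvariant-relabelˡ : ∀ N F → PatternInvariant N F → ∀ i {m b u v} → b ≤ m → m ≤ N → All (_< b) u →
                            All (_≤ N) v → F (insert i m u) v ≡ F (insert i b u) v
PatternInvariant-relabelˡ N F inv i {m} {b} {u} {v} b≤m m≤N u<b v≤N = begin
  F (insert i m u) v
    ≡⟨ inv (insert i m u) v g id (extend-within u<m i m≤N (≤-trans b≤m m≤N) u<b (λ _ _ → refl)) (id-within v≤N) ⟨
  F (map g (insert i m u)) (map id v)
    ≡⟨ cong₂ F (trans (map-extend-insert u<m i) (cong (insert i b) (map-id u))) (map-id v) ⟩
  F (insert i b u) v
    ∎
  where
  open ≡-Reasoning
  g = extend id m b
  u<m = All.map (λ x<b → <-≤-trans x<b b≤m) u<b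

PatternInvariant-relabelʳ : ∀ N F → PatternInvariant N F → ∀ i {m b u v} → b ≤ m → m ≤ N → All (_< b) v →
                            All (_≤ N) u → F u (insert i m v) ≡ F u (insert i b v)
PatternInvariant-relabelʳ N F inv i = PatternInvariant-relabelˡ N (λ x y → F y x) (PatternInvariant-swap F inv) i

-- Splitting a permutation into a prefix and a suffix

perms-≤ : ∀ {n N} → n ≤ N → All (All (_≤ N)) (perms n)
perms-≤ n≤N = All.map (λ (w≤n , _) → All.map (λ x≤n → ≤-trans x≤n n≤N) w≤n) (perms-bounded _)

perms-< : ∀ {n b} → n < b → All (All (_< b)) (perms n)
perms-< n<b = All.map (All.map (λ x≤n → ≤-trans (s≤s x≤n) n<b)) (perms-≤ ≤-refl)

∑perms² : ℕ → ℕ → (List ℕ → List ℕ → ℕ) → ℕ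
∑perms² j k F = ∑[ p ∈ perms j ] ∑[ q ∈ perms k ] F p q

SplitsAt : ℕ → Set
SplitsAt n = ∀ j → j ≤ n → ∀ F → PatternInvariant n F →
             ∑[ w ∈ perms n ] F (take j w) (drop j w) ≡ (n C j) * ∑perms² j (n ∸ j) F

module _ n (split : SplitsAt n) F (inv : PatternInvariant (suc n) F) where

  private
    open ≡-Reasoning
    inserted : ℕ → ℕ → List ℕ → ℕ
    inserted j i w = F (take j (insert i (suc n) w)) (drop j (insert i (suc n) w))

  ∑-insert-in-prefix : ∀ j → j ≤ n →
    ∑[ i < suc j ] ∑[ w ∈ perms n ] inserted (suc j) i w ≡ (n C j) * ∑perms² (suc j) (n ∸ j) F
  ∑-insert-in-prefix j j≤n = begin
    ∑[ i < suc j ] ∑[ w ∈ perms n ] inserted (suc j) i w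
      ≡⟨ ∑<-cong (suc j) (λ i<1+j → relabelled (≤-pred i<1+j)) ⟩
    ∑[ i < suc j ] ((n C j) * ∑[ p ∈ perms j ] H (insert i (suc j) p))
      ≡⟨ *-distribˡ-∑< (n C j) (suc j) (λ i → ∑[ p ∈ perms j ] H (insert i (suc j) p)) ⟨
    (n C j) * ∑[ i < suc j ] ∑[ p ∈ perms j ] H (insert i (suc j) p)
      ≡⟨ cong ((n C j) *_) (∑-perms-suc j H) ⟨
    (n C j) * ∑ (perms (suc j)) H
      ∎
    where
    H : List ℕ → ℕ
    H p = ∑[ q ∈ perms (n ∸ j) ] F p q
    relabelled : ∀ {i} → i ≤ j →
                 ∑[ w ∈ perms n ] inserted (suc j) i w ≡ (n C j) * ∑[ p ∈ perms j ] H (insert i (suc j) p)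
    relabelled {i} i≤j = begin
      ∑[ w ∈ perms n ] inserted (suc j) i w
        ≡⟨ ∑-cong (perms n) (λ w → cong₂ F (take-insert-≤ (suc n) w i≤j) (drop-insert-≤ (suc n) w i≤j)) ⟩
      ∑[ w ∈ perms n ] F (insert i (suc n) (take j w)) (drop j w)
        ≡⟨ split j j≤n (λ u v → F (insert i (suc n) u) v) (PatternInvariant-insertˡ n i F inv) ⟩
      (n C j) * ∑[ p ∈ perms j ] ∑[ q ∈ perms (n ∸ j) ] F (insert i (suc n) p) q
        ≡⟨ cong ((n C j) *_) (∑-cong-All (All.map (λ p<1+j → ∑-cong-All (All.map
             (PatternInvariant-relabelˡ (suc n) F inv i (s≤s j≤n) ≤-refl p<1+j)
             (perms-≤ (≤-trans (m∸n≤m n j) (n≤1+n n))))) (perms-< ≤-refl))) ⟩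
      (n C j) * ∑[ p ∈ perms j ] H (insert i (suc j) p)
        ∎

  ∑-insert-in-suffix : ∀ j → j < n →
    ∑[ i < n ∸ j ] ∑[ w ∈ perms n ] inserted (suc j) (suc j + i) w ≡ (n C suc j) * ∑perms² (suc j) (n ∸ j) F
  ∑-insert-in-suffix j j<n = begin
    ∑[ i < n ∸ j ] ∑[ w ∈ perms n ] inserted (suc j) (suc j + i) w
      ≡⟨ cong (λ t → ∑< t (λ i → ∑[ w ∈ perms n ] inserted (suc j) (suc j + i) w)) n∸j≡t ⟩
    ∑[ i < t ] ∑[ w ∈ perms n ] inserted (suc j) (suc j + i) w
      ≡⟨ ∑<-cong′ t relabelled ⟩
    ∑[ i < t ] ((n C suc j) * ∑[ p ∈ perms (suc j) ] K i p)
      ≡⟨ *-distribˡ-∑< (n C suc j) t (λ i → ∑[ p ∈ perms (suc j) ] K i p) ⟨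
    (n C suc j) * ∑[ i < t ] ∑[ p ∈ perms (suc j) ] K i p
      ≡⟨ cong ((n C suc j) *_) (∑<-∑-comm t (perms (suc j)) K) ⟩
    (n C suc j) * ∑[ p ∈ perms (suc j) ] ∑[ i < t ] K i p
      ≡⟨ cong ((n C suc j) *_) (∑-cong (perms (suc j)) (λ p → ∑-perms-suc (n ∸ suc j) (F p))) ⟨
    (n C suc j) * ∑perms² (suc j) t F
      ≡⟨ cong (λ t → (n C suc j) * ∑perms² (suc j) t F) n∸j≡t ⟨
    (n C suc j) * ∑perms² (suc j) (n ∸ j) F
      ∎
    where
    t = suc (n ∸ suc j)
    n∸j≡t : n ∸ j ≡ t
    n∸j≡t = +-∸-assoc 1 j<n
    K : ℕ → List ℕ → ℕ
    K i p = ∑[ q ∈ perms (n ∸ suc j) ] F p (insert i t q)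
    relabelled : ∀ i → ∑[ w ∈ perms n ] inserted (suc j) (suc j + i) w ≡ (n C suc j) * ∑[ p ∈ perms (suc j) ] K i p
    relabelled i = begin
      ∑[ w ∈ perms n ] inserted (suc j) (suc j + i) w
        ≡⟨ ∑-cong-All (All.map (λ {w} (_ , |w|≡n) → let j<|w| = subst (suc j ≤_) (sym |w|≡n) j<n in
             cong₂ F (take-insert-+ (suc j) i (suc n) w j<|w|) (drop-insert-+ (suc j) i (suc n) w j<|w|))
             (perms-bounded n)) ⟩
      ∑[ w ∈ perms n ] F (take (suc j) w) (insert i (suc n) (drop (suc j) w))
        ≡⟨ split (suc j) j<n (λ u v → F u (insert i (suc n) v)) (PatternInvariant-insertʳ n i F inv) ⟩
      (n C suc j) * ∑[ p ∈ perms (suc j) ] ∑[ q ∈ perms (n ∸ suc j) ] F p (insert i (suc n) q)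
        ≡⟨ cong ((n C suc j) *_) (∑-cong-All (All.map (λ p≤ → ∑-cong-All (All.map
             (λ q<t → PatternInvariant-relabelʳ (suc n) F inv i (s≤s (m∸n≤m n (suc j))) ≤-refl q<t p≤)
             (perms-< ≤-refl))) (perms-≤ (≤-trans j<n (n≤1+n n))))) ⟩
      (n C suc j) * ∑[ p ∈ perms (suc j) ] K i p
        ∎

-- Inserting the largest letter n + 1 in one of the j + 1 gaps of the prefix or the n - j gaps of the
-- suffix: the two cases contribute C(n, j) and C(n, j + 1), and Pascal's rule combines them.
∑-perms-split : ∀ n → SplitsAt n
∑-perms-split n       zero    _         F _   = sym (trans (*-identityˡ _) (+-identityʳ _))
∑-perms-split (suc n) (suc j) (s≤s j≤n) F inv = begin
  ∑[ w ∈ perms (suc n) ] G w                           ≡⟨ ∑-perms-suc n G ⟩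
  ∑[ i < suc n ] G′ i                                  ≡⟨ cong (λ k → ∑< k G′) (m+[n∸m]≡n (s≤s j≤n)) ⟨
  ∑[ i < suc j + (n ∸ j) ] G′ i                        ≡⟨ ∑<-+ (suc j) (n ∸ j) G′ ⟩
  ∑[ i < suc j ] G′ i + ∑[ i < n ∸ j ] G′ (suc j + i)  ≡⟨ cong₂ _+_ prefix suffix ⟩
  (n C j) * X + (n C suc j) * X                        ≡⟨ *-distribʳ-+ X (n C j) (n C suc j) ⟨
  (n C j + n C suc j) * X                              ≡⟨ cong (_* X) (nCk+nC[k+1]≡[n+1]C[k+1] n j) ⟩
  (suc n C suc j) * X                                  ∎
  where
  open ≡-Reasoning
  G : List ℕ → ℕ
  G w = F (take (suc j) w) (drop (suc j) w)
  G′ : ℕ → ℕ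
  G′ i = ∑[ w ∈ perms n ] G (insert i (suc n) w)
  X = ∑perms² (suc j) (n ∸ j) F
  prefix : ∑[ i < suc j ] G′ i ≡ (n C j) * X
  prefix = ∑-insert-in-prefix n (∑-perms-split n) F inv j j≤n
  suffix : ∑[ i < n ∸ j ] G′ (suc j + i) ≡ (n C suc j) * X
  suffix with m≤n⇒m<n∨m≡n j≤n
  ... | inj₁ j<n  = ∑-insert-in-suffix n (∑-perms-split n) F inv j j<n
  ... | inj₂ refl =
    trans (cong (λ k → ∑[ i < k ] G′ (suc j + i)) (n∸n≡0 j)) (sym (cong (_* X) (k>n⇒nCk≡0 (n<1+n j))))

-- Evaluating the inner sum

evenFloor≡2*⌊n/2⌋ : ∀ n → evenFloor n ≡ 2 * ⌊ n /2⌋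
evenFloor≡2*⌊n/2⌋ zero          = refl
evenFloor≡2*⌊n/2⌋ (suc zero)    = refl
evenFloor≡2*⌊n/2⌋ (suc (suc n)) = trans (cong (2 +_) (evenFloor≡2*⌊n/2⌋ n)) (sym (*-suc 2 ⌊ n /2⌋))

⟦≡ᵇ2r⟧+⟦≡ᵇ2r+1⟧ : ∀ x r → ⟦ x ≡ᵇ 2 * r ⟧ + ⟦ x ≡ᵇ 2 * r + 1 ⟧ ≡ ⟦ ⌊ x /2⌋ ≡ᵇ r ⟧
⟦≡ᵇ2r⟧+⟦≡ᵇ2r+1⟧ zero          zero    = refl
⟦≡ᵇ2r⟧+⟦≡ᵇ2r+1⟧ zero          (suc r) = refl
⟦≡ᵇ2r⟧+⟦≡ᵇ2r+1⟧ (suc zero)    zero    = refl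
⟦≡ᵇ2r⟧+⟦≡ᵇ2r+1⟧ (suc zero)    (suc r) rewrite +-suc r (r + 0) = refl
⟦≡ᵇ2r⟧+⟦≡ᵇ2r+1⟧ (suc (suc x)) zero    = refl
⟦≡ᵇ2r⟧+⟦≡ᵇ2r+1⟧ (suc (suc x)) (suc r) rewrite +-suc r (r + 0) = ⟦≡ᵇ2r⟧+⟦≡ᵇ2r+1⟧ x r

-- Only r = ⌊x/2⌋ and s = y contribute, and they lie in the summation range as soon as 2r + s = k.
∑∑-collapse : ∀ k x y →
  ∑[ r < suc (suc k) ] ∑[ s < suc (suc k) ]
    (⟦ 2 * r + s ≡ᵇ k ⟧ * ((⟦ x ≡ᵇ 2 * r ⟧ + ⟦ x ≡ᵇ 2 * r + 1 ⟧) * ⟦ y ≡ᵇ s ⟧))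
  ≡ ⟦ evenFloor x + suc y ≡ᵇ suc k ⟧
∑∑-collapse k x y = begin
  ∑[ r < N ] ∑[ s < N ] (⟦ 2 * r + s ≡ᵇ k ⟧ * (χ r * ⟦ y ≡ᵇ s ⟧))
    ≡⟨ ∑<-cong′ N inner ⟩
  ∑[ r < N ] (⟦ ⌊ x /2⌋ ≡ᵇ r ⟧ * ⟦ 2 * r + y ≡ᵇ k ⟧)
    ≡⟨ ∑<-δ N ⌊ x /2⌋ (λ r → ⟦ 2 * r + y ≡ᵇ k ⟧) (λ ≮N → ¬T⇒⟦⟧≡0 (≮N ∘ ⌊x/2⌋<N)) ⟩
  ⟦ 2 * ⌊ x /2⌋ + y ≡ᵇ k ⟧
    ≡⟨ cong (λ e → ⟦ suc (e + y) ≡ᵇ suc k ⟧) (evenFloor≡2*⌊n/2⌋ x) ⟨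
  ⟦ suc (evenFloor x + y) ≡ᵇ suc k ⟧
    ≡⟨ cong (λ e → ⟦ e ≡ᵇ suc k ⟧) (+-suc (evenFloor x) y) ⟨
  ⟦ evenFloor x + suc y ≡ᵇ suc k ⟧
    ∎
  where
  open ≡-Reasoning
  N = suc (suc k)
  χ : ℕ → ℕ
  χ r = ⟦ x ≡ᵇ 2 * r ⟧ + ⟦ x ≡ᵇ 2 * r + 1 ⟧
  ≤k⇒<N : ∀ {m} → m ≤ k → m < N
  ≤k⇒<N m≤k = s≤s (m≤n⇒m≤1+n m≤k)
  ⌊x/2⌋<N : T (2 * ⌊ x /2⌋ + y ≡ᵇ k) → ⌊ x /2⌋ < N
  ⌊x/2⌋<N e = ≤k⇒<N (≤-trans (m≤m+n ⌊ x /2⌋ _) (≤-trans (m≤m+n _ y) (≤-reflexive (≡ᵇ⇒≡ _ k e))))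
  inner : ∀ r → ∑[ s < N ] (⟦ 2 * r + s ≡ᵇ k ⟧ * (χ r * ⟦ y ≡ᵇ s ⟧)) ≡
                ⟦ ⌊ x /2⌋ ≡ᵇ r ⟧ * ⟦ 2 * r + y ≡ᵇ k ⟧
  inner r = begin
    ∑[ s < N ] (⟦ 2 * r + s ≡ᵇ k ⟧ * (χ r * ⟦ y ≡ᵇ s ⟧))
      ≡⟨ ∑<-cong′ N (λ s → rearrange ⟦ 2 * r + s ≡ᵇ k ⟧ (χ r) ⟦ y ≡ᵇ s ⟧) ⟩
    ∑[ s < N ] (⟦ y ≡ᵇ s ⟧ * (⟦ 2 * r + s ≡ᵇ k ⟧ * χ r))
      ≡⟨ ∑<-δ N y (λ s → ⟦ 2 * r + s ≡ᵇ k ⟧ * χ r) (cong (_* χ r) ∘ ¬T⇒⟦⟧≡0 ∘ (_∘ y<N)) ⟩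
    ⟦ 2 * r + y ≡ᵇ k ⟧ * χ r
      ≡⟨ *-comm _ (χ r) ⟩
    χ r * ⟦ 2 * r + y ≡ᵇ k ⟧
      ≡⟨ cong (_* ⟦ 2 * r + y ≡ᵇ k ⟧) (⟦≡ᵇ2r⟧+⟦≡ᵇ2r+1⟧ x r) ⟩
    ⟦ ⌊ x /2⌋ ≡ᵇ r ⟧ * ⟦ 2 * r + y ≡ᵇ k ⟧
      ∎
    where
    y<N : T (2 * r + y ≡ᵇ k) → y < N
    y<N e = ≤k⇒<N (≤-trans (m≤n+m y (2 * r)) (≤-reflexive (≡ᵇ⇒≡ _ k e)))
    rearrange : ∀ a b c → a * (b * c) ≡ c * (a * b)
    rearrange a b c = trans (sym (*-assoc a b c)) (*-comm (a * b) c)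

innerSum≡∑∑ : ∀ k n j →
  innerSum (suc k) n j ≡ ∑perms² j (n ∸ j) (λ p q → ⟦ asAroundMax p q ≡ᵇ suc k ⟧)
innerSum≡∑∑ k n j = begin
  innerSum (suc k) n j
    ≡⟨ sum-map-applyUpTo (λ r → Σ≤ (suc k) (term r)) id N ⟩
  ∑[ r < N ] Σ≤ (suc k) (term r)
    ≡⟨ ∑<-cong′ N (λ r → trans (sum-map-applyUpTo (term r) id N) (∑<-cong′ N (term≡ r))) ⟩
  ∑[ r < N ] ∑[ s < N ] ∑[ p ∈ P ] ∑[ q ∈ Q ] f r s p q
    ≡⟨ ∑<∑<-∑∑-comm N N P Q f ⟩
  ∑[ p ∈ P ] ∑[ q ∈ Q ] ∑[ r < N ] ∑[ s < N ] f r s p q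
    ≡⟨ ∑-cong P (λ p → ∑-cong Q (λ q → ∑∑-collapse k (as p) (asUp q))) ⟩
  ∑[ p ∈ P ] ∑[ q ∈ Q ] ⟦ asAroundMax p q ≡ᵇ suc k ⟧
    ∎
  where
  open ≡-Reasoning
  N = suc (suc k)
  P = perms j
  Q = perms (n ∸ j)
  term : ℕ → ℕ → ℕ
  term r s = if (2 * r + s) ≡ᵇ k then (a (2 * r) j + a (2 * r + 1) j) * a s (n ∸ j) else 0
  χ : ℕ → List ℕ → ℕ
  χ r p = ⟦ as p ≡ᵇ 2 * r ⟧ + ⟦ as p ≡ᵇ 2 * r + 1 ⟧
  f : ℕ → ℕ → List ℕ → List ℕ → ℕ
  f r s p q = ⟦ 2 * r + s ≡ᵇ k ⟧ * (χ r p * ⟦ asUp q ≡ᵇ s ⟧)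
  term≡ : ∀ r s → term r s ≡ ∑[ p ∈ P ] ∑[ q ∈ Q ] f r s p q
  term≡ r s = begin
    term r s
      ≡⟨ if-then-0≡⟦⟧* (2 * r + s ≡ᵇ k) _ ⟩
    ⟦ 2 * r + s ≡ᵇ k ⟧ * ((a (2 * r) j + a (2 * r + 1) j) * a s (n ∸ j))
      ≡⟨ cong (⟦ 2 * r + s ≡ᵇ k ⟧ *_) (cong₂ _*_ count-as (sym (count-asUp (n ∸ j) s))) ⟩
    ⟦ 2 * r + s ≡ᵇ k ⟧ * (∑ P (χ r) * ∑[ q ∈ Q ] ⟦ asUp q ≡ᵇ s ⟧)
      ≡⟨ *-distrib-∑∑ ⟦ 2 * r + s ≡ᵇ k ⟧ P Q (χ r) (λ q → ⟦ asUp q ≡ᵇ s ⟧) ⟩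
    ∑[ p ∈ P ] ∑[ q ∈ Q ] f r s p q
      ∎
    where
    count-as : a (2 * r) j + a (2 * r + 1) j ≡ ∑ P (χ r)
    count-as = trans (cong₂ _+_ (length-filterᵇ _ P) (length-filterᵇ _ P)) (sym (∑-distrib-+ P _ _))

PatternInvariant-asAroundMax : ∀ N k → PatternInvariant N (λ u v → ⟦ asAroundMax u v ≡ᵇ k ⟧)
PatternInvariant-asAroundMax N k u v g h (_ , _ , g↑) (_ , _ , h↑) =
  cong₂ (λ x y → ⟦ evenFloor x + suc y ≡ᵇ k ⟧) (as-map-preserving g u g↑) (asUp-map-preserving h v h↑)

as-insert-max : ∀ n i w → All (_≤ n) w → as (insert i (suc n) w) ≡ asAroundMax (take i w) (drop i w)
as-insert-max n i w w≤n =
  trans (cong as (insert-≡-++ i (suc n) w)) (as-++-max (All.take⁺ i w<1+n) (All.drop⁺ i w<1+n))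
  where w<1+n = All.map s≤s w≤n

lemma2p2 : (n k : ℕ) → 1 ≤ k → k ≤ suc n → a k (suc n) ≡ rhs k n
lemma2p2 n (suc k) _ _ = begin
  a (suc k) (suc n)
    ≡⟨ length-filterᵇ (λ w → as w ≡ᵇ suc k) (perms (suc n)) ⟩
  ∑[ w ∈ perms (suc n) ] ⟦ as w ≡ᵇ suc k ⟧
    ≡⟨ ∑-perms-suc n (λ w → ⟦ as w ≡ᵇ suc k ⟧) ⟩
  ∑[ i < suc n ] ∑[ w ∈ perms n ] ⟦ as (insert i (suc n) w) ≡ᵇ suc k ⟧
    ≡⟨ ∑<-cong′ (suc n) (λ i → ∑-cong-All (All.map (λ (w≤n , _) → cong (λ x → ⟦ x ≡ᵇ suc k ⟧)
                                                     (as-insert-max n i _ w≤n)) (perms-bounded n))) ⟩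
  ∑[ i < suc n ] ∑[ w ∈ perms n ] F (take i w) (drop i w)
    ≡⟨ ∑<-cong (suc n) (λ i<1+n → ∑-perms-split n _ (≤-pred i<1+n) F (PatternInvariant-asAroundMax n (suc k))) ⟩
  ∑[ i < suc n ] ((n C i) * ∑perms² i (n ∸ i) F)
    ≡⟨ ∑<-cong′ (suc n) (λ i → cong ((n C i) *_) (innerSum≡∑∑ k n i)) ⟨
  ∑[ i < suc n ] ((n C i) * innerSum (suc k) n i)
    ≡⟨ sum-map-applyUpTo (λ j → (n C j) * innerSum (suc k) n j) id (suc n) ⟨
  rhs (suc k) n
    ∎
  where
  open ≡-Reasoning
  F : List ℕ → List ℕ → ℕ
  F u v = ⟦ asAroundMax u v ≡ᵇ suc k ⟧
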